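{- Let $\mathbf{c}=1\,0^{\mu_1}\,1\,0^{\mu_2}\,1\,0^{\mu_3}\,1\cdots$ be a zero-one sequence beginning with $1$ and containing infinitely many $1$'s ($0^{\mu}$ denotes a block of $\mu\ge0$ zeros), and let $S=\theta(\mathbf{c})=\{S_0<S_1<\cdots\}$ be the corresponding sum-free set. For $n\ge1$ let $\alpha_n$ be the number of integers $i$ with $S_{n-1}<i<S_n$ and $i\in S+S$, and let $h(n)=\sum_{i=1}^{2^{n-1}}(\mu_i+\alpha_i)+2^{n-1}$. Suppose that for every $m\ge1$, \[ \mu_{2^m}>\sum_{i=1}^{2^m-1}\mu_i+2^m+\frac{3^m-1}{2}\qquad\text{and}\qquad \mu_{2^m+k}=\mu_k\ \text{ for all } 0<k<2^m . \] Then for every integer $n\ge1$: (1) if $n=2^k(2j+1)$ with $k,j\ge0$, then $\alpha_n=\frac{3^k+1}{2}$; (2) if $n=\sum_{i=1}^m\epsilon_i2^{i-1}$ with $\epsilon_i\in\{0,1\}$ (the binary expansion of $n$), then $S_n=1+\sum_{i=1}^m\epsilon_i h(i)$.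
   Context: A set $S$ of positive integers is sum-free if there are no $x,y,z\in S$ ($x,y$ not necessarily distinct) with $x+y=z$; $S+S=\{x+y:x,y\in S\}$. Cameron's bijection $\theta$ from infinite zero-one sequences to sum-free sets of positive integers: given a zero-one sequence $\mathbf{w}=w_0w_1\cdots$, examine $n=1,2,3,\dots$ in increasing order; if $n=x+y$ for some $x,y$ already placed in $S$ (possibly $x=y$), label $n$ by $\ast$ and $n\notin S$; otherwise read the next unread symbol of $\mathbf{w}$ and put $n\in S$ iff that symbol is $1$. Then $\theta(\mathbf{w})=S$; equivalently labelling $n$ by $1$ if $n\in S$, by $\ast$ if $n\in S+S$ and by $0$ otherwise, $\mathbf{w}$ is obtained from the label sequence by deleting all $\ast$'s. Elements of $S$ are listed increasingly as $S_0<S_1<\cdots$. -}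

module Defs where

open import Data.Nat using (ℕ; zero; suc; _+_; _*_; _≡ᵇ_; _<ᵇ_)
open import Data.Bool using (Bool; true; false; if_then_else_; _∧_; _∨_)
open import Data.List using (List; []; _∷_)
open import Data.Bool.ListAction using (any)
open import Data.Product using (_×_; _,_; proj₁; proj₂)

Σ1 : ℕ → (ℕ → ℕ) → ℕ
Σ1 zero    f = 0
Σ1 (suc n) f = Σ1 n f + f (suc n)

anyUpTo : ℕ → (ℕ → Bool) → Bool
anyUpTo zero    p = p zero
anyUpTo (suc n) p = anyUpTo n p ∨ p (suc n)

countFrom : ℕ → ℕ → (ℕ → Bool) → ℕ
countFrom a zero      p = 0
countFrom a (suc len) p = (if p a then 1 else 0) + countFrom (suc a) len p

isSumOf : List ℕ → ℕ → Bool
isSumOf L m = any (λ x → any (λ y → (x + y) ≡ᵇ m) L) L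

memb : ℕ → List ℕ → Bool
memb n L = any (λ x → x ≡ᵇ n) L

-- Cameron's procedure θ: after examining 1,...,n, the elements of S placed so far
-- and the number of symbols of w read so far.
run : (ℕ → Bool) → ℕ → List ℕ × ℕ
run w zero = [] , 0
run w (suc n) with run w n
... | L , p = if isSumOf L (suc n) then (L , p)
              else (if w p then (suc n ∷ L , suc p) else (L , suc p))

inθ : (ℕ → Bool) → ℕ → Bool
inθ w n = memb n (proj₁ (run w n))

inθθ : (ℕ → Bool) → ℕ → Bool
inθθ w n = anyUpTo n (λ x → anyUpTo n (λ y → inθ w x ∧ inθ w y ∧ ((x + y) ≡ᵇ n)))

countBelow : (ℕ → Bool) → ℕ → ℕ
countBelow w x = countFrom 0 x (inθ w)

-- x is S_n (0-indexed n-th smallest element of θ(w))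
IsNth : (ℕ → Bool) → ℕ → ℕ → Set
IsNth w n x = (inθ w x ≡ true) × (countBelow w x ≡ n)
  where open import Relation.Binary.PropositionalEquality using (_≡_)

-- c = 1 0^{μ 1} 1 0^{μ 2} 1 ... (μ 0 is unused).
-- The i-th 1 (i ≥ 0) sits at position i + μ 1 + ... + μ i.
onePos : (ℕ → ℕ) → ℕ → ℕ
onePos μ i = i + Σ1 i μ

cSeq : (ℕ → ℕ) → ℕ → Bool
cSeq μ p = anyUpTo p (λ i → onePos μ i ≡ᵇ p)

-- α_n for n ≥ 1, given s with s k = S_k : #{i : s(n-1) < i < s n, i ∈ S+S}
α : (ℕ → ℕ) → (ℕ → ℕ) → ℕ → ℕ
α μ s zero    = 0
α μ s (suc n) = countFrom (suc (s n)) (s (suc n) Data.Nat.∸ suc (s n)) (inθθ (cSeq μ))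

h : (ℕ → ℕ) → (ℕ → ℕ) → ℕ → ℕ
h μ s zero    = 0
h μ s (suc n) = Σ1 (2 Data.Nat.^ n) (λ i → μ i + α μ s i) + 2 Data.Nat.^ n

bit : Bool → ℕ
bit true  = 1
bit false = 0

{-# OPTIONS --safe #-}
module Submission where

-- Label n ≥ 1 by 1, ∗ or 0 according as n ∈ S, n ∈ S + S or neither.  The
-- hypotheses make the label word self-similar: if W is the word of
-- [1, h(m+1)] and p = S (2^m − 1) its last 1, then the word of [1, h(m+2)] is
-- W W W′ 0⋯0, where W′ is the prefix of length 2p of W with its 1s turned
-- into 0s.  Sums within the second copy of W are exactly the stars of W′;
-- the periodicity of μ makes the second copy read from c the same symbols as
-- the first, and the growth of μ (2^(m+1)) makes c supply only zeros until
-- the word is complete.  So S (2^m + k) = h(m+1) + S k for k < 2^m, which is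
-- the binary formula for S n and gives α (2^m + k) = α k; counting stars
-- (their number in [1, 2p] triples at each level) gives α (2^m) = (3^m + 1)/2.

open import Defs
open import Data.Nat using (ℕ; zero; suc; _+_; _*_; _^_; _∸_; _<_; _≤_; z≤n; s≤s; _≡ᵇ_; _≤?_; _<?_)
open import Data.Nat.Properties
open import Data.Nat.DivMod using (_/_; m*n/n≡m)
open import Data.Nat.Induction using (<-rec)
open import Data.Nat.Tactic.RingSolver using (solve-∀)
open import Algebra.Properties.CommutativeSemigroup +-commutativeSemigroup
  using () renaming (interchange to +-interchange; x∙yz≈y∙xz to x+[y+z]≡y+[x+z])
open import Data.Bool using (Bool; true; false; if_then_else_; _∧_; _∨_; not)
open import Data.Bool.Properties using (∨-zeroʳ; T-≡)
open import Data.Bool.ListAction using (any)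
open import Data.List using (List; _∷_)
open import Data.Product using (_×_; _,_; proj₁; proj₂; ∃)
open import Data.Sum using (_⊎_; inj₁; inj₂)
open import Data.Empty using (⊥-elim)
open import Function.Bundles using (module Equivalence)
open import Relation.Nullary using (¬_; yes; no)
open import Relation.Binary.PropositionalEquality
open import Relation.Binary.Definitions using (tri<; tri≈; tri>)

≡ᵇ-true⇒≡ : ∀ m n → (m ≡ᵇ n) ≡ true → m ≡ n
≡ᵇ-true⇒≡ m n e = ≡ᵇ⇒≡ m n (Equivalence.from T-≡ e)

≡⇒≡ᵇ-true : ∀ {m n} → m ≡ n → (m ≡ᵇ n) ≡ true
≡⇒≡ᵇ-true {m} {n} e = Equivalence.to T-≡ (≡⇒≡ᵇ m n e)

∨-true⁻ : ∀ a b → a ∨ b ≡ true → a ≡ true ⊎ b ≡ true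
∨-true⁻ true  b _ = inj₁ refl
∨-true⁻ false b e = inj₂ e

∨-trueˡ : ∀ {a} b → a ≡ true → a ∨ b ≡ true
∨-trueˡ b e = cong (_∨ b) e

∨-trueʳ : ∀ a {b} → b ≡ true → a ∨ b ≡ true
∨-trueʳ a e = trans (cong (a ∨_) e) (∨-zeroʳ a)

∧-true⁻ : ∀ a b → a ∧ b ≡ true → a ≡ true × b ≡ true
∧-true⁻ true true _ = refl , refl

≡-by-true : ∀ a b → (a ≡ true → b ≡ true) → (b ≡ true → a ≡ true) → a ≡ b
≡-by-true true  true  _ _ = refl
≡-by-true true  false f _ = sym (f refl)
≡-by-true false true  _ g = g refl
≡-by-true false false _ _ = refl

true≢false : true ≢ false
true≢false ()

summand≤ : ∀ {a b n} → 1 ≤ b → a + b ≡ suc n → a ≤ n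
summand≤ {a} {b} 1≤b a+b≡ = ≤-pred (subst (suc a ≤_) a+b≡ (subst (_≤ a + b) (+-comm a 1) (+-monoʳ-≤ a 1≤b)))

+≡⇒≤ˡ : ∀ {a b x y} → a + b ≡ x → x ≤ y → a ≤ y
+≡⇒≤ˡ {a} {b} refl x≤y = ≤-trans (m≤m+n a b) x≤y

+≡⇒≤ʳ : ∀ {a b x y} → a + b ≡ x → x ≤ y → b ≤ y
+≡⇒≤ʳ {a} {b} refl x≤y = ≤-trans (m≤n+m b a) x≤y

anyUpTo⁺ : ∀ n f i → i ≤ n → f i ≡ true → anyUpTo n f ≡ true
anyUpTo⁺ zero    f .zero z≤n e = e
anyUpTo⁺ (suc n) f i i≤ e with m≤n⇒m<n∨m≡n i≤
... | inj₁ (s≤s i≤n) = ∨-trueˡ _ (anyUpTo⁺ n f i i≤n e)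
... | inj₂ refl      = ∨-trueʳ (anyUpTo n f) e

anyUpTo⁻ : ∀ n f → anyUpTo n f ≡ true → ∃ λ i → i ≤ n × f i ≡ true
anyUpTo⁻ zero    f e = zero , z≤n , e
anyUpTo⁻ (suc n) f e with ∨-true⁻ (anyUpTo n f) (f (suc n)) e
... | inj₁ e′ = let (i , i≤n , fi) = anyUpTo⁻ n f e′ in i , m≤n⇒m≤1+n i≤n , fi
... | inj₂ e′ = suc n , ≤-refl , e′

anyUpTo-cong : ∀ n f g → (∀ i → i ≤ n → f i ≡ g i) → anyUpTo n f ≡ anyUpTo n g
anyUpTo-cong zero    f g f≡g = f≡g zero z≤n
anyUpTo-cong (suc n) f g f≡g =
  cong₂ _∨_ (anyUpTo-cong n f g (λ i i≤n → f≡g i (m≤n⇒m≤1+n i≤n))) (f≡g (suc n) ≤-refl)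

any⁻ : ∀ f L → any f L ≡ true → ∃ λ a → memb a L ≡ true × f a ≡ true
any⁻ f (x ∷ L) e with ∨-true⁻ (f x) (any f L) e
... | inj₁ e′ = x , ∨-trueˡ _ (≡⇒≡ᵇ-true {x} refl) , e′
... | inj₂ e′ = let (a , a∈L , fa) = any⁻ f L e′ in a , ∨-trueʳ (x ≡ᵇ a) a∈L , fa

any⁺ : ∀ f L a → memb a L ≡ true → f a ≡ true → any f L ≡ true
any⁺ f (x ∷ L) a a∈ fa with ∨-true⁻ (x ≡ᵇ a) (memb a L) a∈
... | inj₁ x≡a = ∨-trueˡ _ (subst (λ z → f z ≡ true) (sym (≡ᵇ-true⇒≡ x a x≡a)) fa)
... | inj₂ a∈L = ∨-trueʳ (f x) (any⁺ f L a a∈L fa)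

indicator : Bool → ℕ
indicator b = if b then 1 else 0

countFrom-+ : ∀ a l₁ l₂ g → countFrom a (l₁ + l₂) g ≡ countFrom a l₁ g + countFrom (a + l₁) l₂ g
countFrom-+ a zero      l₂ g = cong (λ z → countFrom z l₂ g) (sym (+-identityʳ a))
countFrom-+ a (suc l₁) l₂ g = begin
  indicator (g a) + countFrom (suc a) (l₁ + l₂) g
    ≡⟨ cong (indicator (g a) +_) (countFrom-+ (suc a) l₁ l₂ g) ⟩
  indicator (g a) + (countFrom (suc a) l₁ g + countFrom (suc a + l₁) l₂ g)
    ≡⟨ sym (+-assoc (indicator (g a)) _ _) ⟩
  indicator (g a) + countFrom (suc a) l₁ g + countFrom (suc a + l₁) l₂ g
    ≡⟨ cong (λ z → indicator (g a) + countFrom (suc a) l₁ g + countFrom z l₂ g) (sym (+-suc a l₁)) ⟩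
  indicator (g a) + countFrom (suc a) l₁ g + countFrom (a + suc l₁) l₂ g ∎
  where open ≡-Reasoning

countFrom-ext : ∀ a b l g g′ → (∀ i → i < l → g (a + i) ≡ g′ (b + i)) → countFrom a l g ≡ countFrom b l g′
countFrom-ext a b zero    g g′ g≡g′ = refl
countFrom-ext a b (suc l) g g′ g≡g′ = cong₂ _+_ (cong indicator first) (countFrom-ext (suc a) (suc b) l g g′ rest)
  where
  first : g a ≡ g′ b
  first = subst₂ (λ x y → g x ≡ g′ y) (+-identityʳ a) (+-identityʳ b) (g≡g′ 0 (s≤s z≤n))
  rest : ∀ i → i < l → g (suc a + i) ≡ g′ (suc b + i)
  rest i i<l = subst₂ (λ x y → g x ≡ g′ y) (+-suc a i) (+-suc b i) (g≡g′ (suc i) (s≤s i<l))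

countFrom-cong : ∀ a l g g′ → (∀ x → g x ≡ g′ x) → countFrom a l g ≡ countFrom a l g′
countFrom-cong a l g g′ g≡g′ = countFrom-ext a a l g g′ (λ i _ → g≡g′ (a + i))

countFrom-false : ∀ a l → countFrom a l (λ _ → false) ≡ 0
countFrom-false a zero    = refl
countFrom-false a (suc l) = countFrom-false (suc a) l

countFrom-true : ∀ a l → countFrom a l (λ _ → true) ≡ l
countFrom-true a zero    = refl
countFrom-true a (suc l) = cong suc (countFrom-true (suc a) l)

countFrom-none : ∀ a l g → (∀ i → i < l → g (a + i) ≡ false) → countFrom a l g ≡ 0
countFrom-none a l g none = trans (countFrom-ext a a l g (λ _ → false) none) (countFrom-false a l)

countFrom-not : ∀ a l g → countFrom a l g + countFrom a l (λ x → not (g x)) ≡ l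
countFrom-not a zero    g = refl
countFrom-not a (suc l) g with g a
... | true  = cong suc (countFrom-not (suc a) l g)
... | false = trans (+-suc (countFrom (suc a) l g) _) (cong suc (countFrom-not (suc a) l g))

countFrom-mono : ∀ a {l l′} g → l ≤ l′ → countFrom a l g ≤ countFrom a l′ g
countFrom-mono a {l} g l≤l′ with m≤n⇒∃[o]m+o≡n l≤l′
... | k , refl = subst (countFrom a l g ≤_) (sym (countFrom-+ a l k g)) (m≤m+n _ _)

countFrom-suc : ∀ a l g → countFrom a (suc l) g ≡ countFrom a l g + indicator (g (a + l))
countFrom-suc a l g = begin
  countFrom a (suc l) g                              ≡⟨ cong (λ z → countFrom a z g) (+-comm 1 l) ⟩
  countFrom a (l + 1) g                              ≡⟨ countFrom-+ a l 1 g ⟩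
  countFrom a l g + (indicator (g (a + l)) + 0)      ≡⟨ cong (countFrom a l g +_) (+-identityʳ _) ⟩
  countFrom a l g + indicator (g (a + l))            ∎
  where open ≡-Reasoning

module Cameron (w : ℕ → Bool) (inS : ℕ → Bool) (0∉S : inS 0 ≡ false) where

  inSS : ℕ → Bool
  inSS n = anyUpTo n (λ x → anyUpTo n (λ y → inS x ∧ inS y ∧ (x + y ≡ᵇ n)))

  inS-pos : ∀ x → inS x ≡ true → 1 ≤ x
  inS-pos zero    x∈S = ⊥-elim (true≢false (trans (sym x∈S) 0∉S))
  inS-pos (suc x) _   = s≤s z≤n

  inSS⁻ : ∀ n → inSS n ≡ true → ∃ λ a → ∃ λ b → inS a ≡ true × inS b ≡ true × a + b ≡ n
  inSS⁻ n e =
    let (a , _ , e₁) = anyUpTo⁻ n _ e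
        (b , _ , e₂) = anyUpTo⁻ n _ e₁
        (a∈S , e₃)   = ∧-true⁻ (inS a) _ e₂
        (b∈S , e₄)   = ∧-true⁻ (inS b) _ e₃
    in a , b , a∈S , b∈S , ≡ᵇ-true⇒≡ (a + b) n e₄

  inSS⁺ : ∀ n a b → inS a ≡ true → inS b ≡ true → a + b ≡ n → inSS n ≡ true
  inSS⁺ n a b a∈S b∈S refl =
    anyUpTo⁺ n _ a (m≤m+n a b) (anyUpTo⁺ n _ b (m≤n+m b a) (cong₂ _∧_ a∈S (cong₂ _∧_ b∈S (≡⇒≡ᵇ-true {a + b} refl))))

  -- The number of symbols of w read while examining 1, …, n.
  read : ℕ → ℕ
  read n = countFrom 1 n (λ x → not (inSS x))

  read-sum : ∀ n → inSS (suc n) ≡ true → read (suc n) ≡ read n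
  read-sum n sum = begin
    read (suc n)                               ≡⟨ countFrom-suc 1 n _ ⟩
    read n + indicator (not (inSS (suc n)))    ≡⟨ cong (λ b → read n + indicator (not b)) sum ⟩
    read n + 0                                 ≡⟨ +-identityʳ _ ⟩
    read n                                     ∎
    where open ≡-Reasoning

  read-nonsum : ∀ n → inSS (suc n) ≡ false → read (suc n) ≡ suc (read n)
  read-nonsum n nonsum = begin
    read (suc n)                               ≡⟨ countFrom-suc 1 n _ ⟩
    read n + indicator (not (inSS (suc n)))    ≡⟨ cong (λ b → read n + indicator (not b)) nonsum ⟩
    read n + 1                                 ≡⟨ +-comm _ 1 ⟩
    suc (read n)                               ∎
    where open ≡-Reasoning

  Sound Complete : ℕ → List ℕ → Set
  Sound    n L = ∀ x → memb x L ≡ true → inS x ≡ true × x ≤ n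
  Complete n L = ∀ x → inS x ≡ true → x ≤ n → memb x L ≡ true

  Sound-suc : ∀ {n L} → Sound n L → Sound (suc n) L
  Sound-suc sound x x∈L = let (x∈S , x≤n) = sound x x∈L in x∈S , m≤n⇒m≤1+n x≤n

  Complete-suc : ∀ {n L} → Complete n L → inS (suc n) ≡ false → Complete (suc n) L
  Complete-suc complete n+1∉S x x∈S x≤n+1 with m≤n⇒m<n∨m≡n x≤n+1
  ... | inj₁ (s≤s x≤n) = complete x x∈S x≤n
  ... | inj₂ refl      = ⊥-elim (true≢false (trans (sym x∈S) n+1∉S))

  Sound-∷ : ∀ {n L} → Sound n L → inS (suc n) ≡ true → Sound (suc n) (suc n ∷ L)
  Sound-∷ {n} {L} sound n+1∈S x x∈ with ∨-true⁻ (suc n ≡ᵇ x) (memb x L) x∈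
  ... | inj₁ n+1≡x with ≡ᵇ-true⇒≡ (suc n) x n+1≡x
  ...   | refl = n+1∈S , ≤-refl
  Sound-∷ {n} {L} sound n+1∈S x x∈ | inj₂ x∈L = Sound-suc {n} {L} sound x x∈L

  Complete-∷ : ∀ {n L} → Complete n L → Complete (suc n) (suc n ∷ L)
  Complete-∷ {n} complete x x∈S x≤n+1 with m≤n⇒m<n∨m≡n x≤n+1
  ... | inj₁ (s≤s x≤n) = ∨-trueʳ (suc n ≡ᵇ x) (complete x x∈S x≤n)
  ... | inj₂ refl      = ∨-trueˡ _ (≡⇒≡ᵇ-true {suc n} refl)

  isSumOf-correct : ∀ {n L} → Sound n L → Complete n L → isSumOf L (suc n) ≡ inSS (suc n)
  isSumOf-correct {n} {L} sound complete = ≡-by-true _ _ to from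
    where
    to : isSumOf L (suc n) ≡ true → inSS (suc n) ≡ true
    to e = let (a , a∈L , e₁) = any⁻ _ L e
               (b , b∈L , e₂) = any⁻ _ L e₁
           in inSS⁺ (suc n) a b (proj₁ (sound a a∈L)) (proj₁ (sound b b∈L)) (≡ᵇ-true⇒≡ _ _ e₂)
    from : inSS (suc n) ≡ true → isSumOf L (suc n) ≡ true
    from e = let (a , b , a∈S , b∈S , a+b≡) = inSS⁻ (suc n) e
             in any⁺ _ L a (complete a a∈S (summand≤ (inS-pos b b∈S) a+b≡))
                  (any⁺ _ L b (complete b b∈S (summand≤ (inS-pos a a∈S) (trans (+-comm b a) a+b≡)))
                    (≡⇒≡ᵇ-true a+b≡))

  module Run (sum-free  : ∀ n → inSS (suc n) ≡ true → inS (suc n) ≡ false)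
             (follows-w : ∀ n → inSS (suc n) ≡ false → w (read n) ≡ inS (suc n)) where

    Invariant : ℕ → List ℕ × ℕ → Set
    Invariant n (L , q) = (Sound n L × Complete n L) × q ≡ read n

    run-invariant : ∀ n → Invariant n (run w n)
    run-invariant zero = ((λ _ ()) , λ { zero 0∈S _ → ⊥-elim (true≢false (trans (sym 0∈S) 0∉S)) }) , refl
    run-invariant (suc n) with run w n | run-invariant n
    ... | L , q | (sound , complete) , refl rewrite isSumOf-correct {n} {L} sound complete with inSS (suc n) in sum
    ...   | true = (Sound-suc {n} {L} sound , Complete-suc {n} {L} complete (sum-free n sum)) , sym (read-sum n sum)
    ...   | false with w (read n) in wₙ
    ...     | true  = (Sound-∷ {n} {L} sound (trans (sym (follows-w n sum)) wₙ) , Complete-∷ {n} {L} complete)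
                    , sym (read-nonsum n sum)
    ...     | false = (Sound-suc {n} {L} sound , Complete-suc {n} {L} complete (trans (sym (follows-w n sum)) wₙ))
                    , sym (read-nonsum n sum)

    inθ-correct : ∀ n → inθ w n ≡ inS n
    inθ-correct n with run w n | run-invariant n
    ... | L , _ | (sound , complete) , _ = ≡-by-true _ _ (λ n∈L → proj₁ (sound n n∈L)) (λ n∈S → complete n n∈S ≤-refl)

    inθθ-correct : ∀ n → inθθ w n ≡ inSS n
    inθθ-correct n = anyUpTo-cong n _ _ λ x _ → anyUpTo-cong n _ _ λ y _ →
      cong₂ (λ u v → u ∧ v ∧ (x + y ≡ᵇ n)) (inθ-correct x) (inθ-correct y)

data Label : Set where
  one star blank : Label

isOne isStar notStar : Label → Bool
isOne one  = true
isOne _    = false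
isStar star = true
isStar _    = false
notStar l = not (isStar l)

keepStar : Label → Label
keepStar star = star
keepStar _    = blank

isOne-keepStar : ∀ l → isOne (keepStar l) ≡ false
isOne-keepStar one   = refl
isOne-keepStar star  = refl
isOne-keepStar blank = refl

isStar-keepStar : ∀ l → isStar (keepStar l) ≡ isStar l
isStar-keepStar one   = refl
isStar-keepStar star  = refl
isStar-keepStar blank = refl

keepStar≡star⇒≡star : ∀ l → keepStar l ≡ star → l ≡ star
keepStar≡star⇒≡star star _ = refl

keepStar≢one : ∀ l → keepStar l ≢ one
keepStar≢one one   ()
keepStar≢one star  ()
keepStar≢one blank ()

isOne⇒≡one : ∀ l → isOne l ≡ true → l ≡ one
isOne⇒≡one one _ = refl

isStar⇒≡star : ∀ l → isStar l ≡ true → l ≡ star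
isStar⇒≡star star _ = refl

double : ℕ → ℕ → (ℕ → Label) → ℕ → Label
double H p f x with x ≤? H
... | yes _ = f x
... | no _ with x ≤? H + H
...   | yes _ = f (x ∸ H)
...   | no _ with x ≤? H + H + (p + p)
...     | yes _ = keepStar (f (x ∸ (H + H)))
...     | no _  = blank

module Doubling (H p : ℕ) (f : ℕ → Label) where

  g : ℕ → Label
  g = double H p f

  H<H+y : ∀ {y} → 1 ≤ y → H < H + y
  H<H+y {y} 1≤y = subst (_≤ H + y) (+-comm H 1) (+-monoʳ-≤ H 1≤y)

  double-first : ∀ x → x ≤ H → g x ≡ f x
  double-first x x≤H with x ≤? H
  ... | yes _   = refl
  ... | no x≰H = ⊥-elim (x≰H x≤H)

  double-second : ∀ y → 1 ≤ y → y ≤ H → g (H + y) ≡ f y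
  double-second y 1≤y y≤H with H + y ≤? H
  ... | yes le = ⊥-elim (<⇒≱ (H<H+y 1≤y) le)
  ... | no _ with H + y ≤? H + H
  ...   | yes _  = cong f (m+n∸m≡n H y)
  ...   | no ≰ = ⊥-elim (≰ (+-monoʳ-≤ H y≤H))

  double-third : ∀ y → 1 ≤ y → y ≤ p + p → g (H + H + y) ≡ keepStar (f y)
  double-third y 1≤y y≤2p with H + H + y ≤? H
  ... | yes le = ⊥-elim (<⇒≱ (≤-trans (H<H+y 1≤y) (+-monoˡ-≤ y (m≤m+n H H))) le)
  ... | no _ with H + H + y ≤? H + H
  ...   | yes le = ⊥-elim (<⇒≱ (subst (_≤ H + H + y) (+-comm (H + H) 1) (+-monoʳ-≤ (H + H) 1≤y)) le)
  ...   | no _ with H + H + y ≤? H + H + (p + p)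
  ...     | yes _  = cong (λ z → keepStar (f z)) (m+n∸m≡n (H + H) y)
  ...     | no ≰ = ⊥-elim (≰ (+-monoʳ-≤ (H + H) y≤2p))

  double-beyond : ∀ x → H + H + (p + p) < x → g x ≡ blank
  double-beyond x lt with x ≤? H
  ... | yes le = ⊥-elim (<⇒≱ lt (≤-trans le (≤-trans (m≤m+n H H) (m≤m+n (H + H) (p + p)))))
  ... | no _ with x ≤? H + H
  ...   | yes le = ⊥-elim (<⇒≱ lt (≤-trans le (m≤m+n (H + H) (p + p))))
  ...   | no _ with x ≤? H + H + (p + p)
  ...     | yes le = ⊥-elim (<⇒≱ lt le)
  ...     | no _   = refl

  data Block (x : ℕ) : Set where
    first  : x ≤ H → Block x
    second : ∀ y → 1 ≤ y → y ≤ H → x ≡ H + y → Block x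
    third  : ∀ y → 1 ≤ y → y ≤ p + p → x ≡ H + H + y → Block x
    beyond : H + H + (p + p) < x → Block x

  ≰⇒≡+pos : ∀ a x → ¬ (x ≤ a) → ∃ λ y → 1 ≤ y × x ≡ a + y
  ≰⇒≡+pos a x x≰a with m≤n⇒∃[o]m+o≡n (<⇒≤ (≰⇒> x≰a))
  ... | zero  , e = ⊥-elim (x≰a (≤-reflexive (trans (sym e) (+-identityʳ a))))
  ... | suc k , e = suc k , s≤s z≤n , sym e

  block : ∀ x → Block x
  block x with x ≤? H
  ... | yes x≤H = first x≤H
  ... | no x≰H with x ≤? H + H
  ...   | yes x≤2H = let (y , 1≤y , e) = ≰⇒≡+pos H x x≰H
                     in second y 1≤y (+-cancelˡ-≤ H y H (subst (_≤ H + H) e x≤2H)) e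
  ...   | no x≰2H with x ≤? H + H + (p + p)
  ...     | yes x≤ = let (y , 1≤y , e) = ≰⇒≡+pos (H + H) x x≰2H
                     in third y 1≤y (+-cancelˡ-≤ (H + H) y (p + p) (subst (_≤ H + H + (p + p)) e x≤)) e
  ...     | no x≰  = beyond (≰⇒> x≰)

  module _ (G : Label → Bool) where

    count-first : ∀ l → l ≤ H → countFrom 1 l (λ x → G (g x)) ≡ countFrom 1 l (λ x → G (f x))
    count-first l l≤H = countFrom-ext 1 1 l _ _ (λ i i<l → cong G (double-first (suc i) (≤-trans i<l l≤H)))

    count-second : ∀ l → l ≤ H → countFrom (suc H) l (λ x → G (g x)) ≡ countFrom 1 l (λ x → G (f x))
    count-second l l≤H = countFrom-ext (suc H) 1 l _ _ λ i i<l →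
      cong G (trans (cong g (sym (+-suc H i))) (double-second (suc i) (s≤s z≤n) (≤-trans i<l l≤H)))

    count-third : countFrom (suc (H + H)) (p + p) (λ x → G (g x)) ≡ countFrom 1 (p + p) (λ x → G (keepStar (f x)))
    count-third = countFrom-ext (suc (H + H)) 1 (p + p) _ _ λ i i<2p →
      cong G (trans (cong g (sym (+-suc (H + H) i))) (double-third (suc i) (s≤s z≤n) i<2p))

    count-beyond : ∀ z → countFrom (suc (H + H + (p + p))) z (λ x → G (g x)) ≡ countFrom 0 z (λ _ → G blank)
    count-beyond z = countFrom-ext _ 0 z _ _ (λ i _ → cong G (double-beyond _ (s≤s (m≤m+n _ i))))

    count-firstTwo : countFrom 1 (H + H) (λ x → G (g x)) ≡ countFrom 1 H (λ x → G (f x)) + countFrom 1 H (λ x → G (f x))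
    count-firstTwo = trans (countFrom-+ 1 H H _) (cong₂ _+_ (count-first H ≤-refl) (count-second H ≤-refl))

    count-firstThree : countFrom 1 (H + H + (p + p)) (λ x → G (g x))
                     ≡ countFrom 1 H (λ x → G (f x)) + countFrom 1 H (λ x → G (f x))
                       + countFrom 1 (p + p) (λ x → G (keepStar (f x)))
    count-firstThree = trans (countFrom-+ 1 (H + H) (p + p) _) (cong₂ _+_ count-firstTwo count-third)

    count-all : ∀ z → countFrom 1 (H + H + (p + p) + z) (λ x → G (g x))
              ≡ countFrom 1 H (λ x → G (f x)) + countFrom 1 H (λ x → G (f x))
                + countFrom 1 (p + p) (λ x → G (keepStar (f x))) + countFrom 0 z (λ _ → G blank)
    count-all z = trans (countFrom-+ 1 (H + H + (p + p)) z _) (cong₂ _+_ count-firstThree (count-beyond z))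

countFrom-notStar-suc : ∀ (f : ℕ → Label) x → isStar (f (suc x)) ≡ false
                      → countFrom 1 (suc x) (λ y → notStar (f y)) ≡ suc (countFrom 1 x (λ y → notStar (f y)))
countFrom-notStar-suc f x e = begin
  countFrom 1 (suc x) F                                   ≡⟨ countFrom-suc 1 x F ⟩
  countFrom 1 x F + indicator (not (isStar (f (suc x))))  ≡⟨ cong (λ b → countFrom 1 x F + indicator (not b)) e ⟩
  countFrom 1 x F + 1                                     ≡⟨ +-comm _ 1 ⟩
  suc (countFrom 1 x F)                                   ∎
  where
  open ≡-Reasoning
  F = λ y → notStar (f y)

-- f labels [0, H] exactly as Cameron's procedure run on c does: p is the
-- largest 1, and there are n₁ 1s, n⋆ stars (all in [1, 2p]) and r symbols read.
record Prefix (c : ℕ → Bool) (f : ℕ → Label) (H p n₁ n⋆ r : ℕ) : Set where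
  field
    label-0     : f 0 ≡ blank
    1≤p         : 1 ≤ p
    2p≤H        : p + p ≤ H
    p-one       : f p ≡ one
    one⇒≤p      : ∀ x → x ≤ H → f x ≡ one → x ≤ p
    star⇒sum    : ∀ x → x ≤ H → f x ≡ star → ∃ λ a → ∃ λ b → f a ≡ one × f b ≡ one × a + b ≡ x
    sum⇒star    : ∀ a b → a ≤ H → b ≤ H → f a ≡ one → f b ≡ one → f (a + b) ≡ star
    count-ones  : countFrom 1 H (λ x → isOne (f x)) ≡ n₁
    count-stars : countFrom 1 (p + p) (λ x → isStar (f x)) ≡ n⋆
    count-read  : countFrom 1 H (λ x → notStar (f x)) ≡ r
    follows-c   : ∀ x → x < H → isStar (f (suc x)) ≡ false
                → c (countFrom 1 x (λ y → notStar (f y))) ≡ isOne (f (suc x))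

module DoublingStep {c : ℕ → Bool} {f : ℕ → Label} {H p n₁ n⋆ r : ℕ} (prefix : Prefix c f H p n₁ n⋆ r)
  (H′ r′ : ℕ) (room : H + H + (p + p) ≤ H′)
  (r′≡ : r + r + ((p + p) ∸ n⋆) + (H′ ∸ (H + H + (p + p))) ≡ r′)
  (c-periodic : ∀ q → q < r → c (r + q) ≡ c q)
  (c-zeros : ∀ q → r + r ≤ q → q < r′ → c q ≡ false) where

  open Prefix prefix
  open Doubling H p f

  z : ℕ
  z = H′ ∸ (H + H + (p + p))

  H′≡ : H + H + (p + p) + z ≡ H′
  H′≡ = m+[n∸m]≡n room

  one-pos : ∀ a → f a ≡ one → 1 ≤ a
  one-pos zero fa with trans (sym fa) label-0
  ... | ()
  one-pos (suc a) _ = s≤s z≤n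

  p≤H : p ≤ H
  p≤H = ≤-trans (m≤m+n p p) 2p≤H

  data OneIn (a : ℕ) : Set where
    inFirst  : a ≤ p → f a ≡ one → OneIn a
    inSecond : ∀ a′ → 1 ≤ a′ → a′ ≤ p → a ≡ H + a′ → f a′ ≡ one → OneIn a

  one-block : ∀ a → g a ≡ one → OneIn a
  one-block a ga with block a
  ... | first a≤H = let fa = trans (sym (double-first a a≤H)) ga in inFirst (one⇒≤p a a≤H fa) fa
  ... | second y 1≤y y≤H refl = let fy = trans (sym (double-second y 1≤y y≤H)) ga in inSecond y 1≤y (one⇒≤p y y≤H fy) refl fy
  ... | third y 1≤y y≤2p refl = ⊥-elim (keepStar≢one _ (trans (sym (double-third y 1≤y y≤2p)) ga))
  ... | beyond lt with trans (sym ga) (double-beyond a lt)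
  ...   | ()

  one⇒≤H+p : ∀ x → x ≤ H′ → g x ≡ one → x ≤ H + p
  one⇒≤H+p x _ gx with one-block x gx
  ... | inFirst x≤p _ = ≤-trans x≤p (m≤n+m p H)
  ... | inSecond x′ _ x′≤p refl _ = +-monoʳ-≤ H x′≤p

  star⇒sum′ : ∀ x → x ≤ H′ → g x ≡ star → ∃ λ a → ∃ λ b → g a ≡ one × g b ≡ one × a + b ≡ x
  star⇒sum′ x _ gx with block x
  ... | first x≤H =
        let (a , b , fa , fb , a+b≡) = star⇒sum x x≤H (trans (sym (double-first x x≤H)) gx)
        in a , b , trans (double-first a (+≡⇒≤ˡ a+b≡ x≤H)) fa , trans (double-first b (+≡⇒≤ʳ a+b≡ x≤H)) fb , a+b≡
  ... | second y 1≤y y≤H refl =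
        let (a , b , fa , fb , a+b≡) = star⇒sum y y≤H (trans (sym (double-second y 1≤y y≤H)) gx)
        in H + a , b , trans (double-second a (one-pos a fa) (+≡⇒≤ˡ a+b≡ y≤H)) fa ,
           trans (double-first b (+≡⇒≤ʳ a+b≡ y≤H)) fb , trans (+-assoc H a b) (cong (H +_) a+b≡)
  ... | third y 1≤y y≤2p refl =
        let y≤H = ≤-trans y≤2p 2p≤H
            (a , b , fa , fb , a+b≡) = star⇒sum y y≤H (keepStar≡star⇒≡star _ (trans (sym (double-third y 1≤y y≤2p)) gx))
        in H + a , H + b , trans (double-second a (one-pos a fa) (+≡⇒≤ˡ a+b≡ y≤H)) fa ,
           trans (double-second b (one-pos b fb) (+≡⇒≤ʳ a+b≡ y≤H)) fb ,
           trans (+-interchange H a H b) (cong (H + H +_) a+b≡)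
  ... | beyond lt with trans (sym gx) (double-beyond x lt)
  ...   | ()

  ≤p+≤p⇒≤H : ∀ {a b} → a ≤ p → b ≤ p → a + b ≤ H
  ≤p+≤p⇒≤H a≤p b≤p = ≤-trans (+-mono-≤ a≤p b≤p) 2p≤H

  sum⇒star-≤p : ∀ {a b} → a ≤ p → b ≤ p → f a ≡ one → f b ≡ one → f (a + b) ≡ star
  sum⇒star-≤p a≤p b≤p = sum⇒star _ _ (≤-trans a≤p p≤H) (≤-trans b≤p p≤H)

  sum⇒star′ : ∀ a b → a ≤ H′ → b ≤ H′ → g a ≡ one → g b ≡ one → g (a + b) ≡ star
  sum⇒star′ a b _ _ ga gb with one-block a ga | one-block b gb
  ... | inFirst a≤p fa | inFirst b≤p fb =
        trans (double-first (a + b) (≤p+≤p⇒≤H a≤p b≤p)) (sum⇒star-≤p a≤p b≤p fa fb)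
  ... | inSecond a′ 1≤a′ a′≤p refl fa | inFirst b≤p fb =
        trans (cong g (+-assoc H a′ b))
          (trans (double-second (a′ + b) (≤-trans 1≤a′ (m≤m+n a′ b)) (≤p+≤p⇒≤H a′≤p b≤p))
            (sum⇒star-≤p a′≤p b≤p fa fb))
  ... | inFirst a≤p fa | inSecond b′ 1≤b′ b′≤p refl fb =
        trans (cong g (x+[y+z]≡y+[x+z] a H b′))
          (trans (double-second (a + b′) (≤-trans 1≤b′ (m≤n+m b′ a)) (≤p+≤p⇒≤H a≤p b′≤p))
            (sum⇒star-≤p a≤p b′≤p fa fb))
  ... | inSecond a′ 1≤a′ a′≤p refl fa | inSecond b′ 1≤b′ b′≤p refl fb =
        trans (cong g (+-interchange H a′ H b′))
          (trans (double-third (a′ + b′) (≤-trans 1≤a′ (m≤m+n a′ b′)) (+-mono-≤ a′≤p b′≤p))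
            (cong keepStar (sum⇒star-≤p a′≤p b′≤p fa fb)))

  no-star-beyond-2p : ∀ x → p + p < x → x ≤ H → isStar (f x) ≡ false
  no-star-beyond-2p x 2p<x x≤H with f x in fx
  ... | one   = refl
  ... | blank = refl
  ... | star  =
        let (a , b , fa , fb , a+b≡) = star⇒sum x x≤H fx
        in ⊥-elim (<⇒≱ 2p<x (subst (_≤ p + p) a+b≡
             (+-mono-≤ (one⇒≤p a (+≡⇒≤ˡ a+b≡ x≤H) fa) (one⇒≤p b (+≡⇒≤ʳ a+b≡ x≤H) fb))))

  count-stars-H : countFrom 1 H (λ x → isStar (f x)) ≡ n⋆
  count-stars-H = begin
    countFrom 1 H (λ x → isStar (f x))
      ≡⟨ cong (λ l → countFrom 1 l _) (sym (m+[n∸m]≡n 2p≤H)) ⟩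
    countFrom 1 (p + p + (H ∸ (p + p))) (λ x → isStar (f x))
      ≡⟨ countFrom-+ 1 (p + p) (H ∸ (p + p)) _ ⟩
    countFrom 1 (p + p) (λ x → isStar (f x)) + countFrom (suc (p + p)) (H ∸ (p + p)) (λ x → isStar (f x))
      ≡⟨ cong₂ _+_ count-stars (countFrom-none _ _ _ λ i i< → no-star-beyond-2p _ (s≤s (m≤m+n _ i)) (above i i<)) ⟩
    n⋆ + 0
      ≡⟨ +-identityʳ n⋆ ⟩
    n⋆ ∎
    where
    open ≡-Reasoning
    above : ∀ i → i < H ∸ (p + p) → suc (p + p) + i ≤ H
    above i i< = subst (_≤ H) (+-suc (p + p) i) (≤-trans (+-monoʳ-≤ (p + p) i<) (≤-reflexive (m+[n∸m]≡n 2p≤H)))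

  count-doubled : ∀ (G : Label → Bool) → countFrom 1 H′ (λ x → G (g x))
                ≡ countFrom 1 H (λ x → G (f x)) + countFrom 1 H (λ x → G (f x))
                  + countFrom 1 (p + p) (λ x → G (keepStar (f x))) + countFrom 0 z (λ _ → G blank)
  count-doubled G = trans (cong (λ l → countFrom 1 l (λ x → G (g x))) (sym H′≡)) (count-all G z)

  count-ones′ : countFrom 1 H′ (λ x → isOne (g x)) ≡ n₁ + n₁
  count-ones′ = begin
    countFrom 1 H′ (λ x → isOne (g x))
      ≡⟨ count-doubled isOne ⟩
    countFrom 1 H (λ x → isOne (f x)) + countFrom 1 H (λ x → isOne (f x))
      + countFrom 1 (p + p) (λ x → isOne (keepStar (f x))) + countFrom 0 z (λ _ → false)
      ≡⟨ cong₂ _+_ (cong₂ _+_ (cong₂ _+_ count-ones count-ones) no-ones) (countFrom-false 0 z) ⟩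
    n₁ + n₁ + 0 + 0
      ≡⟨ trans (+-identityʳ _) (+-identityʳ _) ⟩
    n₁ + n₁ ∎
    where
    open ≡-Reasoning
    no-ones : countFrom 1 (p + p) (λ x → isOne (keepStar (f x))) ≡ 0
    no-ones = trans (countFrom-cong 1 (p + p) _ _ (λ x → isOne-keepStar (f x))) (countFrom-false 1 (p + p))

  count-stars′ : countFrom 1 ((H + p) + (H + p)) (λ x → isStar (g x)) ≡ n⋆ + n⋆ + n⋆
  count-stars′ = begin
    countFrom 1 ((H + p) + (H + p)) (λ x → isStar (g x))
      ≡⟨ cong (λ l → countFrom 1 l (λ x → isStar (g x))) (+-interchange H p H p) ⟩
    countFrom 1 (H + H + (p + p)) (λ x → isStar (g x))
      ≡⟨ count-firstThree isStar ⟩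
    countFrom 1 H (λ x → isStar (f x)) + countFrom 1 H (λ x → isStar (f x))
      + countFrom 1 (p + p) (λ x → isStar (keepStar (f x)))
      ≡⟨ cong₂ _+_ (cong₂ _+_ count-stars-H count-stars-H)
           (trans (countFrom-cong 1 (p + p) _ _ (λ x → isStar-keepStar (f x))) count-stars) ⟩
    n⋆ + n⋆ + n⋆ ∎
    where open ≡-Reasoning

  count-read′ : countFrom 1 H′ (λ x → notStar (g x)) ≡ r′
  count-read′ = begin
    countFrom 1 H′ (λ x → notStar (g x))
      ≡⟨ count-doubled notStar ⟩
    countFrom 1 H (λ x → notStar (f x)) + countFrom 1 H (λ x → notStar (f x))
      + countFrom 1 (p + p) (λ x → notStar (keepStar (f x))) + countFrom 0 z (λ _ → true)
      ≡⟨ cong₂ _+_ (cong₂ _+_ (cong₂ _+_ count-read count-read) read-third) (countFrom-true 0 z) ⟩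
    r + r + ((p + p) ∸ n⋆) + z
      ≡⟨ r′≡ ⟩
    r′ ∎
    where
    open ≡-Reasoning
    notStars : countFrom 1 (p + p) (λ x → notStar (f x)) ≡ (p + p) ∸ n⋆
    notStars = trans (sym (m+n∸m≡n n⋆ _))
      (cong (_∸ n⋆) (trans (cong (_+ _) (sym count-stars)) (countFrom-not 1 (p + p) (λ x → isStar (f x)))))
    read-third : countFrom 1 (p + p) (λ x → notStar (keepStar (f x))) ≡ (p + p) ∸ n⋆
    read-third = trans (countFrom-cong 1 (p + p) _ _ (λ x → cong not (isStar-keepStar (f x)))) notStars

  read : ℕ → ℕ
  read n = countFrom 1 n (λ y → notStar (g y))

  read-late : ∀ x → H + H ≤ x → x < H′ → isStar (g (suc x)) ≡ false → r + r ≤ read x × read x < r′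
  read-late x 2H≤x x<H′ e = lo , hi
    where
    lo : r + r ≤ read x
    lo = subst (_≤ read x) (trans (count-firstTwo notStar) (cong₂ _+_ count-read count-read))
           (countFrom-mono 1 _ 2H≤x)
    hi : read x < r′
    hi = subst (suc (read x) ≤_) count-read′
           (subst (_≤ read H′) (countFrom-notStar-suc g x e) (countFrom-mono 1 _ x<H′))

  follows-c′ : ∀ x → x < H′ → isStar (g (suc x)) ≡ false → c (read x) ≡ isOne (g (suc x))
  follows-c′ x x<H′ e with block (suc x)
  ... | first x<H =
        let fx = double-first (suc x) x<H
        in trans (cong c (count-first notStar x (≤-trans (n≤1+n x) x<H)))
             (trans (follows-c x x<H (trans (cong isStar (sym fx)) e)) (cong isOne (sym fx)))
  ... | second zero () _ _
  ... | second (suc y) _ y<H x+1≡ rewrite suc-injective (trans x+1≡ (+-suc H y)) =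
        let gy = trans (cong g (sym (+-suc H y))) (double-second (suc y) (s≤s z≤n) y<H)
            q = countFrom 1 y (λ u → notStar (f u))
            fy = trans (cong isStar (sym gy)) e
            q<r : q < r
            q<r = subst (_≤ r) (countFrom-notStar-suc f y fy)
                    (subst (countFrom 1 (suc y) (λ u → notStar (f u)) ≤_) count-read (countFrom-mono 1 _ y<H))
            read≡ : read (H + y) ≡ r + q
            read≡ = trans (countFrom-+ 1 H y _)
                      (cong₂ _+_ (trans (count-first notStar H ≤-refl) count-read) (count-second notStar y (≤-trans (n≤1+n y) y<H)))
        in trans (cong c read≡) (trans (c-periodic q q<r) (trans (follows-c y y<H fy) (cong isOne (sym gy))))
  ... | third zero () _ _
  ... | third (suc y) _ y<2p x+1≡ =
        let 2H≤x = subst (H + H ≤_) (sym (suc-injective (trans x+1≡ (+-suc (H + H) y)))) (m≤m+n (H + H) y)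
            (lo , hi) = read-late x 2H≤x x<H′ e
        in trans (c-zeros _ lo hi)
             (sym (trans (cong (λ v → isOne (g v)) x+1≡)
               (trans (cong isOne (double-third (suc y) (s≤s z≤n) y<2p)) (isOne-keepStar _))))
  ... | beyond lt =
        let (lo , hi) = read-late x (≤-trans (m≤m+n (H + H) (p + p)) (≤-pred lt)) x<H′ e
        in trans (c-zeros _ lo hi) (sym (cong isOne (double-beyond (suc x) lt)))

  doubled : Prefix c g H′ (H + p) (n₁ + n₁) (n⋆ + n⋆ + n⋆) r′
  doubled = record
    { label-0     = trans (double-first 0 z≤n) label-0
    ; 1≤p         = ≤-trans 1≤p (m≤n+m p H)
    ; 2p≤H        = subst (_≤ H′) (sym (+-interchange H p H p)) room
    ; p-one       = trans (double-second p 1≤p p≤H) p-one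
    ; one⇒≤p      = one⇒≤H+p
    ; star⇒sum    = star⇒sum′
    ; sum⇒star    = sum⇒star′
    ; count-ones  = count-ones′
    ; count-stars = count-stars′
    ; count-read  = count-read′
    ; follows-c   = follows-c′
    }

1≤2^ : ∀ m → 1 ≤ 2 ^ m
1≤2^ m = m^n>0 2 m

2^≡suc : ∀ m → ∃ λ k → 2 ^ m ≡ suc k
2^≡suc m with 2 ^ m | 1≤2^ m
... | suc k | _ = k , refl

2^-suc : ∀ m → 2 ^ suc m ≡ 2 ^ m + 2 ^ m
2^-suc m = cong (2 ^ m +_) (+-identityʳ _)

dyadic-bracket : ∀ t → 1 ≤ t → ∃ λ M → 2 ^ M ≤ t × t < 2 ^ suc M
dyadic-bracket 1 _ = 0 , s≤s z≤n , s≤s (s≤s z≤n)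
dyadic-bracket (suc (suc t)) _ with dyadic-bracket (suc t) (s≤s z≤n)
... | M , lo , hi with suc (suc t) <? 2 ^ suc M
...   | yes t+2< = M , ≤-trans lo (n≤1+n _) , t+2<
...   | no t+2≮ = suc M , ≤-reflexive 2^≡ ,
                  subst (_< 2 ^ suc (suc M)) 2^≡ (subst (2 ^ suc M <_) (sym (2^-suc (suc M))) (m<m+n _ (1≤2^ (suc M))))
  where
  2^≡ : 2 ^ suc M ≡ suc (suc t)
  2^≡ = ≤-antisym (≮⇒≥ t+2≮) hi

2*≤2*+1⇒≤ : ∀ q j → 2 * q ≤ 2 * j + 1 → q ≤ j
2*≤2*+1⇒≤ q j le = ≤-pred (*-cancelˡ-< 2 q (suc j) (≤-trans (s≤s le) (≤-reflexive (shape j))))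
  where shape : ∀ j → suc (2 * j + 1) ≡ 2 * suc j
        shape = solve-∀

-- Strip the leading binary digit of an odd number 2 j + 1 ≥ 3.
odd-split : ∀ j → 1 ≤ j → ∃ λ M → ∃ λ j′ → j′ < j × 2 * j + 1 ≡ 2 ^ suc M + (2 * j′ + 1)
                                                × 2 * j′ + 1 < 2 ^ suc M
odd-split j 1≤j with dyadic-bracket (2 * j + 1) (m≤n+m 1 (2 * j))
... | zero , _ , 2j+1<2 = ⊥-elim (<⇒≱ 2j+1<2 (≤-trans (*-monoʳ-≤ 2 1≤j) (m≤m+n (2 * j) 1)))
... | suc M , lo , hi with m≤n⇒∃[o]m+o≡n (2*≤2*+1⇒≤ (2 ^ M) j lo)
...   | j′ , refl = M , j′ , m<n+m j′ (1≤2^ M) , split ,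
                    +-cancelˡ-< (2 ^ suc M) _ _ (subst₂ _<_ split (2^-suc (suc M)) hi)
  where
  split : 2 * (2 ^ M + j′) + 1 ≡ 2 ^ suc M + (2 * j′ + 1)
  split = shape (2 ^ M) j′
    where shape : ∀ P j → 2 * (P + j) + 1 ≡ 2 * P + (2 * j + 1)
          shape = solve-∀

initialLabels : ℕ → Label
initialLabels 1 = one
initialLabels 2 = star
initialLabels _ = blank

initialLabels-tail : ∀ (G : Label → Bool) k → countFrom 3 k (λ x → G (initialLabels x)) ≡ countFrom 3 k (λ _ → G blank)
initialLabels-tail G k = countFrom-ext 3 3 k _ _ (λ _ _ → refl)

module Construction (μ : ℕ → ℕ)
  (μ-large : ∀ m → 1 ≤ m → Σ1 (2 ^ m ∸ 1) μ + 2 ^ m + (3 ^ m ∸ 1) / 2 < μ (2 ^ m))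
  (μ-periodic : ∀ m → 1 ≤ m → ∀ k → 0 < k → k < 2 ^ m → μ (2 ^ m + k) ≡ μ k) where

  c : ℕ → Bool
  c = cSeq μ

  pos : ℕ → ℕ
  pos = onePos μ

  pos-suc : ∀ i → pos (suc i) ≡ pos i + suc (μ (suc i))
  pos-suc i = shape i (Σ1 i μ) (μ (suc i))
    where shape : ∀ i S u → suc i + (S + u) ≡ (i + S) + suc u
          shape = solve-∀

  pos-<-suc : ∀ i → pos i < pos (suc i)
  pos-<-suc i = subst (pos i <_) (sym (pos-suc i)) (m<m+n (pos i) (s≤s z≤n))

  pos-mono-< : ∀ i j → i < j → pos i < pos j
  pos-mono-< i (suc j) (s≤s i≤j) with m≤n⇒m<n∨m≡n i≤j
  ... | inj₁ i<j = <-trans (pos-mono-< i j i<j) (pos-<-suc j)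
  ... | inj₂ refl = pos-<-suc i

  pos-mono-≤ : ∀ i j → i ≤ j → pos i ≤ pos j
  pos-mono-≤ i j i≤j with m≤n⇒m<n∨m≡n i≤j
  ... | inj₁ i<j = <⇒≤ (pos-mono-< i j i<j)
  ... | inj₂ refl = ≤-refl

  c-true⇒pos : ∀ q → c q ≡ true → ∃ λ i → pos i ≡ q
  c-true⇒pos q cq = let (i , _ , e) = anyUpTo⁻ q _ cq in i , ≡ᵇ-true⇒≡ _ _ e

  c-pos : ∀ i → c (pos i) ≡ true
  c-pos i = anyUpTo⁺ (pos i) _ i (m≤m+n i _) (≡⇒≡ᵇ-true {pos i} refl)

  c-false : ∀ q → (∀ i → pos i ≢ q) → c q ≡ false
  c-false q ¬pos with c q in cq
  ... | false = refl
  ... | true  = let (i , e) = c-true⇒pos q cq in ⊥-elim (¬pos i e)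

  μ-shift : ∀ m k → suc k < 2 ^ m → μ (2 ^ m + suc k) ≡ μ (suc k)
  μ-shift zero    k (s≤s ())
  μ-shift (suc m) k k<2^m = μ-periodic (suc m) (s≤s z≤n) (suc k) (s≤s z≤n) k<2^m

  Σ1-shift : ∀ m k → k < 2 ^ m → Σ1 (2 ^ m + k) μ ≡ Σ1 (2 ^ m) μ + Σ1 k μ
  Σ1-shift m zero _ = trans (cong (λ z → Σ1 z μ) (+-identityʳ (2 ^ m))) (sym (+-identityʳ _))
  Σ1-shift m (suc k) k<2^m = begin
    Σ1 (2 ^ m + suc k) μ                               ≡⟨ cong (λ z → Σ1 z μ) (+-suc (2 ^ m) k) ⟩
    Σ1 (2 ^ m + k) μ + μ (suc (2 ^ m + k))
      ≡⟨ cong₂ _+_ (Σ1-shift m k (<⇒≤ k<2^m)) (trans (cong μ (sym (+-suc (2 ^ m) k))) (μ-shift m k k<2^m)) ⟩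
    Σ1 (2 ^ m) μ + Σ1 k μ + μ (suc k)                  ≡⟨ +-assoc (Σ1 (2 ^ m) μ) _ _ ⟩
    Σ1 (2 ^ m) μ + Σ1 (suc k) μ                        ∎
    where open ≡-Reasoning

  consumed : ℕ → ℕ
  consumed m = pos (2 ^ m)

  pos-shift : ∀ m k → k < 2 ^ m → pos (2 ^ m + k) ≡ consumed m + pos k
  pos-shift m k k<2^m = trans (cong ((2 ^ m + k) +_) (Σ1-shift m k k<2^m)) (+-interchange (2 ^ m) k _ _)

  μsum : ℕ → ℕ
  μsum m = Σ1 (2 ^ m ∸ 1) μ

  Σ1-2^ : ∀ m → Σ1 (2 ^ m) μ ≡ μsum m + μ (2 ^ m)
  Σ1-2^ m with 2^≡suc m
  ... | k , e rewrite e = refl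

  μsum-suc : ∀ m → μsum (suc m) ≡ μsum m + μ (2 ^ m) + μsum m
  μsum-suc m = begin
    Σ1 (2 ^ suc m ∸ 1) μ                ≡⟨ cong (λ z → Σ1 z μ) (trans (cong (_∸ 1) (2^-suc m)) (+-∸-assoc (2 ^ m) (1≤2^ m))) ⟩
    Σ1 (2 ^ m + (2 ^ m ∸ 1)) μ          ≡⟨ Σ1-shift m (2 ^ m ∸ 1) (∸-monoʳ-< {o = 0} (s≤s z≤n) (1≤2^ m)) ⟩
    Σ1 (2 ^ m) μ + μsum m               ≡⟨ cong (_+ μsum m) (Σ1-2^ m) ⟩
    μsum m + μ (2 ^ m) + μsum m         ∎
    where open ≡-Reasoning

  -- len m is the paper's h(m + 1), the length of the m-th level;
  -- top m = S (2 ^ m ∸ 1) and gapStars m = (3 ^ m + 1) / 2.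
  gapStars top len : ℕ → ℕ
  gapStars zero    = 1
  gapStars (suc m) = gapStars m + 3 ^ m
  top zero    = 1
  top (suc m) = len m + top m
  len m = top m + gapStars m + μ (2 ^ m)

  closed-forms : ∀ m → ∃ λ E → gapStars m ≡ suc E × 3 ^ m ≡ suc (E + E) × top m ≡ 2 ^ m + μsum m + E
  closed-forms zero = 0 , refl , refl , refl
  closed-forms (suc m) with closed-forms m
  ... | E , gs≡ , 3^≡ , top≡ = E + suc (E + E) , cong₂ _+_ gs≡ 3^≡ , trans (cong (3 *_) 3^≡) (3^-shape E) ,
        trans (cong₂ (λ t g → (t + g + μ (2 ^ m)) + t) top≡ gs≡)
          (trans (top-shape (2 ^ m) (μsum m) E (μ (2 ^ m)))
            (cong₂ (λ a b → a + b + (E + suc (E + E))) (sym (2^-suc m)) (sym (μsum-suc m))))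
    where
    3^-shape : ∀ E → 3 * suc (E + E) ≡ suc (E + suc (E + E) + (E + suc (E + E)))
    3^-shape = solve-∀
    top-shape : ∀ P S E u → (P + S + E + suc E + u) + (P + S + E) ≡ (P + P) + (S + u + S) + (E + suc (E + E))
    top-shape = solve-∀

  gapStars≡ : ∀ m → (3 ^ m + 1) / 2 ≡ gapStars m
  gapStars≡ m with closed-forms m
  ... | E , gs≡ , 3^≡ , _ =
        trans (cong (λ z → (z + 1) / 2) 3^≡) (trans (cong (_/ 2) (halve E)) (trans (m*n/n≡m (suc E) 2) (sym gs≡)))
    where halve : ∀ E → suc (E + E) + 1 ≡ suc E * 2
          halve = solve-∀

  len-suc-identity : ∀ {p g t u′} P S E u X d → p ≡ P + S + E → g ≡ suc E → t ≡ suc (E + E)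
    → u′ ≡ suc (S + u + S + (P + P) + X) + d
    → (p + g + u) + (p + g + u) + (p + p) + suc (suc (X + d)) ≡ ((p + g + u) + p) + (g + t) + u′
  len-suc-identity P S E u X d refl refl refl refl = shape P S E u X d
    where
    shape : ∀ P S E u X d → let p = P + S + E in
      (p + suc E + u) + (p + suc E + u) + (p + p) + suc (suc (X + d))
      ≡ ((p + suc E + u) + p) + (suc E + suc (E + E)) + (suc (S + u + S + (P + P) + X) + d)
    shape = solve-∀

  consumed-suc-shape : ∀ P₀ S u X d → let P = suc P₀ ; r = P + (S + u) ; u′ = suc (S + u + S + (P + P) + X) + d in
    r + r + (P₀ + suc P₀ + (S + S)) + suc (suc (X + d)) ≡ (P + P) + ((S + u + S) + u′)
  consumed-suc-shape = solve-∀

  top+top-identity : ∀ {t τ} P₀ S E → t ≡ suc P₀ + S + E → τ ≡ suc (E + E) → t + t ≡ τ + (P₀ + suc P₀ + (S + S))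
  top+top-identity P₀ S E refl refl = shape P₀ S E
    where
    shape : ∀ P₀ S E → (suc P₀ + S + E) + (suc P₀ + S + E) ≡ suc (E + E) + (P₀ + suc P₀ + (S + S))
    shape = solve-∀

  record Growth (m : ℕ) : Set where
    field
      slack        : ℕ
      len-suc      : len m + len m + (top m + top m) + slack ≡ len (suc m)
      consumed-suc : consumed m + consumed m + ((top m + top m) ∸ 3 ^ m)
                     + (len (suc m) ∸ (len m + len m + (top m + top m))) ≡ consumed (suc m)

  -- The hypothesis on μ (2 ^ (m + 1)) is what leaves a positive slack after the three copies of level m.
  growth : ∀ m → Growth m
  growth m with closed-forms m | 2^≡suc m | m≤n⇒∃[o]m+o≡n (μ-large (suc m) (s≤s z≤n))
  ... | E , gs≡ , 3^≡ , top≡ | P₀ , P₀≡ | d , d≡ =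
        record { slack = suc (suc (X + d)) ; len-suc = len-suc′ ; consumed-suc = consumed-suc′ }
    where
    X = (3 ^ suc m ∸ 1) / 2
    u = μ (2 ^ m)
    S = μsum m
    P = 2 ^ m
    u′≡ : μ (2 ^ suc m) ≡ suc (S + u + S + (P + P) + X) + d
    u′≡ = trans (sym d≡) (cong (λ z → suc (z + X) + d) (cong₂ _+_ (μsum-suc m) (2^-suc m)))
    len-suc′ : len m + len m + (top m + top m) + suc (suc (X + d)) ≡ len (suc m)
    len-suc′ = len-suc-identity P S E u X d top≡ gs≡ 3^≡ u′≡
    three = len m + len m + (top m + top m)
    slack≡ : len (suc m) ∸ three ≡ suc (suc (X + d))
    slack≡ = trans (cong (_∸ three) (sym len-suc′)) (m+n∸m≡n three _)
    top-stars≡ : (top m + top m) ∸ 3 ^ m ≡ P₀ + suc P₀ + (S + S)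
    top-stars≡ = trans (cong (_∸ 3 ^ m) (top+top-identity P₀ S E (trans top≡ (cong (λ z → z + S + E) P₀≡)) 3^≡))
                   (m+n∸m≡n (3 ^ m) _)
    consumed≡ : consumed m ≡ suc P₀ + (S + u)
    consumed≡ = cong₂ _+_ P₀≡ (Σ1-2^ m)
    consumed-suc≡ : consumed (suc m) ≡ (suc P₀ + suc P₀) + ((S + u + S) + (suc (S + u + S + (suc P₀ + suc P₀) + X) + d))
    consumed-suc≡ = cong₂ _+_ (trans (2^-suc m) (cong₂ _+_ P₀≡ P₀≡))
      (trans (Σ1-2^ (suc m)) (cong₂ _+_ (μsum-suc m) (trans u′≡ (cong (λ z → suc (S + u + S + (z + z) + X) + d) P₀≡))))
    consumed-suc′ : consumed m + consumed m + ((top m + top m) ∸ 3 ^ m) + (len (suc m) ∸ three) ≡ consumed (suc m)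
    consumed-suc′ = trans (cong₂ _+_ (cong₂ _+_ (cong₂ _+_ consumed≡ consumed≡) top-stars≡) slack≡)
                      (trans (consumed-suc-shape P₀ S u X d) (sym consumed-suc≡))

  consumed-double≤ : ∀ m → consumed m + consumed m ≤ consumed (suc m)
  consumed-double≤ m = ≤-trans (m≤m+n _ _) (≤-trans (m≤m+n _ _) (≤-reflexive (Growth.consumed-suc (growth m))))

  data DyadicRange (m i : ℕ) : Set where
    below  : i < 2 ^ m → DyadicRange m i
    within : ∀ k → k < 2 ^ m → i ≡ 2 ^ m + k → DyadicRange m i
    above  : 2 ^ suc m ≤ i → DyadicRange m i

  dyadicRange : ∀ m i → DyadicRange m i
  dyadicRange m i with i <? 2 ^ m
  ... | yes i<2^m = below i<2^m
  ... | no i≮2^m with m≤n⇒∃[o]m+o≡n (≮⇒≥ i≮2^m)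
  ...   | k , refl with k <? 2 ^ m
  ...     | yes k<2^m = within k k<2^m refl
  ...     | no k≮2^m  = above (subst (_≤ 2 ^ m + k) (sym (2^-suc m)) (+-monoʳ-≤ (2 ^ m) (≮⇒≥ k≮2^m)))

  c-periodic : ∀ m q → q < consumed m → c (consumed m + q) ≡ c q
  c-periodic m q q< = ≡-by-true _ _ to from
    where
    r = consumed m
    to : c (r + q) ≡ true → c q ≡ true
    to cq with c-true⇒pos (r + q) cq
    ... | i , e with dyadicRange m i
    ...   | below i<2^m = ⊥-elim (<⇒≱ (pos-mono-< i (2 ^ m) i<2^m) (≤-trans (m≤m+n r q) (≤-reflexive (sym e))))
    ...   | within k k<2^m refl = subst (λ z → c z ≡ true) (+-cancelˡ-≡ r _ _ (trans (sym (pos-shift m k k<2^m)) e)) (c-pos k)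
    ...   | above 2^m+1≤i = ⊥-elim (<⇒≱ (+-monoʳ-< r q<)
                               (≤-trans (consumed-double≤ m) (≤-trans (pos-mono-≤ _ _ 2^m+1≤i) (≤-reflexive e))))
    from : c q ≡ true → c (r + q) ≡ true
    from cq with c-true⇒pos q cq
    ... | k , e with k <? 2 ^ m
    ...   | yes k<2^m = subst (λ z → c z ≡ true) (trans (pos-shift m k k<2^m) (cong (r +_) e)) (c-pos (2 ^ m + k))
    ...   | no k≮2^m  = ⊥-elim (<⇒≱ q< (subst (r ≤_) e (pos-mono-≤ _ _ (≮⇒≥ k≮2^m))))

  c-zeros : ∀ m q → consumed m + consumed m ≤ q → q < consumed (suc m) → c q ≡ false
  c-zeros m q lo hi = c-false q ¬pos
    where
    r = consumed m
    ¬pos : ∀ i → pos i ≢ q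
    ¬pos i e with dyadicRange m i
    ... | below i<2^m = <⇒≱ (≤-trans (pos-mono-< i (2 ^ m) i<2^m) (m≤m+n r r)) (≤-trans lo (≤-reflexive (sym e)))
    ... | within k k<2^m refl =
          <⇒≱ (subst (_< r + r) (sym (pos-shift m k k<2^m)) (+-monoʳ-< r (pos-mono-< k (2 ^ m) k<2^m))) (≤-trans lo (≤-reflexive (sym e)))
    ... | above 2^m+1≤i = <⇒≱ hi (≤-trans (pos-mono-≤ _ _ 2^m+1≤i) (≤-reflexive e))

  initial-follows-c : ∀ x → x < len 0 → isStar (initialLabels (suc x)) ≡ false
                    → c (countFrom 1 x (λ y → notStar (initialLabels y))) ≡ isOne (initialLabels (suc x))
  initial-follows-c zero _ _ = refl
  initial-follows-c (suc zero) _ ()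
  initial-follows-c (suc (suc k)) (s≤s (s≤s k<μ₁)) _ =
    trans (cong (λ z → c (suc z)) (trans (initialLabels-tail notStar k) (countFrom-true 3 k))) (c-false (suc k) ¬pos)
    where
    ¬pos : ∀ i → pos i ≢ suc k
    ¬pos zero    ()
    ¬pos (suc i) e = <⇒≱ (s≤s k<μ₁) (≤-trans (pos-mono-≤ 1 (suc i) (s≤s z≤n)) (≤-reflexive e))

  initialPrefix : Prefix c initialLabels (len 0) (top 0) (2 ^ 0) (3 ^ 0) (consumed 0)
  initialPrefix = record
    { label-0     = refl
    ; 1≤p         = s≤s z≤n
    ; 2p≤H        = s≤s (s≤s z≤n)
    ; p-one       = refl
    ; one⇒≤p      = λ { 1 _ _ → ≤-refl ; 0 _ () ; 2 _ () ; (suc (suc (suc _))) _ () }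
    ; star⇒sum    = λ { 2 _ _ → 1 , 1 , refl , refl , refl ; 0 _ () ; 1 _ () ; (suc (suc (suc _))) _ () }
    ; sum⇒star    = λ { 1 1 _ _ _ _ → refl ; 0 _ _ _ () _ ; 2 _ _ _ () _ ; (suc (suc (suc _))) _ _ _ () _
                      ; 1 0 _ _ _ () ; 1 2 _ _ _ () ; 1 (suc (suc (suc _))) _ _ _ () }
    ; count-ones  = cong suc (trans (initialLabels-tail isOne (μ 1)) (countFrom-false 3 (μ 1)))
    ; count-stars = refl
    ; count-read  = cong suc (trans (initialLabels-tail notStar (μ 1)) (countFrom-true 3 (μ 1)))
    ; follows-c   = initial-follows-c
    }

  labelsAt : ℕ → ℕ → Label
  labelsAt zero    = initialLabels
  labelsAt (suc m) = double (len m) (top m) (labelsAt m)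

  prefixAt : ∀ m → Prefix c (labelsAt m) (len m) (top m) (2 ^ m) (3 ^ m) (consumed m)
  prefixAt zero    = initialPrefix
  prefixAt (suc m) = subst₂ (λ n₁ n⋆ → Prefix c (labelsAt (suc m)) (len (suc m)) (top (suc m)) n₁ n⋆ (consumed (suc m)))
    (sym (2^-suc m)) (thrice (3 ^ m))
    (DoublingStep.doubled (prefixAt m) (len (suc m)) (consumed (suc m))
      (subst (len m + len m + (top m + top m) ≤_) len-suc (m≤m+n _ slack)) consumed-suc (c-periodic m) (c-zeros m))
    where
    open Growth (growth m)
    thrice : ∀ t → t + t + t ≡ 3 * t
    thrice = solve-∀

  len-double≤ : ∀ m → len m + len m ≤ len (suc m)
  len-double≤ m = ≤-trans (m≤m+n _ (top m + top m)) (≤-trans (m≤m+n _ slack) (≤-reflexive len-suc))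
    where open Growth (growth m)

  len-<-suc : ∀ m → len m < len (suc m)
  len-<-suc m = <-≤-trans (m<m+n (len m) 1≤len) (len-double≤ m)
    where
    1≤len : 1 ≤ len m
    1≤len = ≤-trans (Prefix.1≤p (prefixAt m)) (≤-trans (m≤m+n _ _) (Prefix.2p≤H (prefixAt m)))

  len-mono : ∀ m k → len m ≤ len (m + k)
  len-mono m zero    = ≤-reflexive (cong len (sym (+-identityʳ m)))
  len-mono m (suc k) = ≤-trans (len-mono m k)
    (<⇒≤ (subst (λ z → len (m + k) < len z) (sym (+-suc m k)) (len-<-suc (m + k))))

  n≤len : ∀ n → n ≤ len n
  n≤len zero    = z≤n
  n≤len (suc n) = ≤-trans (s≤s (n≤len n)) (len-<-suc n)

  labelsAt-stable : ∀ m k x → x ≤ len m → labelsAt (m + k) x ≡ labelsAt m x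
  labelsAt-stable m zero    x _ = cong (λ z → labelsAt z x) (+-identityʳ m)
  labelsAt-stable m (suc k) x x≤len = begin
    labelsAt (m + suc k) x   ≡⟨ cong (λ z → labelsAt z x) (+-suc m k) ⟩
    labelsAt (suc (m + k)) x
      ≡⟨ Doubling.double-first (len (m + k)) (top (m + k)) (labelsAt (m + k)) x (≤-trans x≤len (len-mono m k)) ⟩
    labelsAt (m + k) x       ≡⟨ labelsAt-stable m k x x≤len ⟩
    labelsAt m x             ∎
    where open ≡-Reasoning

  -- The levels extend one another, and level x already covers x.
  label : ℕ → Label
  label x = labelsAt x x

  label≡labelsAt : ∀ m x → x ≤ len m → label x ≡ labelsAt m x
  label≡labelsAt m x x≤len with x ≤? m
  ... | yes x≤m with m≤n⇒∃[o]m+o≡n x≤m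
  ...   | k , refl = sym (labelsAt-stable x k x (n≤len x))
  label≡labelsAt m x x≤len | no x≰m with m≤n⇒∃[o]m+o≡n (<⇒≤ (≰⇒> x≰m))
  ...   | k , refl = labelsAt-stable m k (m + k) x≤len

  label-second : ∀ m y → 1 ≤ y → y ≤ len m → label (len m + y) ≡ label y
  label-second m y 1≤y y≤len = begin
    label (len m + y)          ≡⟨ label≡labelsAt (suc m) (len m + y) (≤-trans (+-monoʳ-≤ (len m) y≤len) (len-double≤ m)) ⟩
    labelsAt (suc m) (len m + y) ≡⟨ Doubling.double-second (len m) (top m) (labelsAt m) y 1≤y y≤len ⟩
    labelsAt m y               ≡⟨ sym (label≡labelsAt m y y≤len) ⟩
    label y                    ∎
    where open ≡-Reasoning

  inS : ℕ → Bool
  inS x = isOne (label x)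

  open Cameron c inS refl

  inSS≡isStar : ∀ n → inSS n ≡ isStar (label n)
  inSS≡isStar n = ≡-by-true _ _ to from
    where
    prefix = prefixAt n
    at : ∀ x → x ≤ len n → label x ≡ labelsAt n x
    at = label≡labelsAt n
    n≤ = n≤len n
    to : inSS n ≡ true → isStar (label n) ≡ true
    to sum =
      let (a , b , a∈S , b∈S , a+b≡) = inSS⁻ n sum
          a≤ = +≡⇒≤ˡ a+b≡ n≤
          b≤ = +≡⇒≤ʳ a+b≡ n≤
          star = Prefix.sum⇒star prefix a b a≤ b≤
                   (trans (sym (at a a≤)) (isOne⇒≡one _ a∈S)) (trans (sym (at b b≤)) (isOne⇒≡one _ b∈S))
      in cong isStar (trans (at n n≤) (trans (cong (labelsAt n) (sym a+b≡)) star))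
    from : isStar (label n) ≡ true → inSS n ≡ true
    from st =
      let (a , b , fa , fb , a+b≡) = Prefix.star⇒sum prefix n n≤ (trans (sym (at n n≤)) (isStar⇒≡star _ st))
      in inSS⁺ n a b (cong isOne (trans (at a (+≡⇒≤ˡ a+b≡ n≤)) fa)) (cong isOne (trans (at b (+≡⇒≤ʳ a+b≡ n≤)) fb)) a+b≡

  sums-not-in-S : ∀ n → inSS (suc n) ≡ true → inS (suc n) ≡ false
  sums-not-in-S n sum = cong isOne (isStar⇒≡star _ (trans (sym (inSS≡isStar (suc n))) sum))

  S-follows-c : ∀ n → inSS (suc n) ≡ false → c (read n) ≡ inS (suc n)
  S-follows-c n nonsum = begin
    c (read n)                                            ≡⟨ cong c read≡ ⟩
    c (countFrom 1 n (λ y → notStar (labelsAt m y)))       ≡⟨ Prefix.follows-c (prefixAt m) n (n≤len m) star≡ ⟩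
    isOne (labelsAt m m)                                  ≡⟨ cong isOne (sym (at m (n≤len m))) ⟩
    inS m                                                 ∎
    where
    open ≡-Reasoning
    m = suc n
    at : ∀ x → x ≤ len m → label x ≡ labelsAt m x
    at = label≡labelsAt m
    star≡ : isStar (labelsAt m m) ≡ false
    star≡ = trans (cong isStar (sym (at m (n≤len m)))) (trans (sym (inSS≡isStar m)) nonsum)
    read≡ : read n ≡ countFrom 1 n (λ y → notStar (labelsAt m y))
    read≡ = countFrom-ext 1 1 n _ _ λ i i<n →
      cong not (trans (inSS≡isStar (suc i)) (cong isStar (at (suc i) (≤-trans (s≤s (<⇒≤ i<n)) (n≤len m)))))

  open Run sums-not-in-S S-follows-c public

  inS⇒¬inSS : ∀ x → inS x ≡ true → inSS x ≡ false
  inS⇒¬inSS x x∈S = trans (inSS≡isStar x) (cong isStar (isOne⇒≡one _ x∈S))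

  countS : ℕ → ℕ
  countS x = countFrom 0 x inS

  countS-strict : ∀ x y → inS x ≡ true → x < y → suc (countS x) ≤ countS y
  countS-strict x y x∈S x<y with m≤n⇒∃[o]m+o≡n x<y
  ... | k , refl = subst (suc (countS x) ≤_) (sym split) (subst (_≤ countS x + rest) (+-comm (countS x) 1) (+-monoʳ-≤ (countS x) 1≤))
    where
    rest = indicator (inS x) + countFrom (suc x) k inS
    split : countS (suc x + k) ≡ countS x + rest
    split = trans (cong countS (sym (+-suc x k))) (countFrom-+ 0 x (suc k) inS)
    1≤ : 1 ≤ rest
    1≤ rewrite x∈S = s≤s z≤n

  c-ones-read : ∀ n → countFrom 0 (read n) c ≡ countFrom 1 n inS
  c-ones-read zero = refl
  c-ones-read (suc n) with inSS (suc n) in sum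
  ... | true = begin
    countFrom 0 (read (suc n)) c          ≡⟨ cong (λ z → countFrom 0 z c) (read-sum n sum) ⟩
    countFrom 0 (read n) c                ≡⟨ c-ones-read n ⟩
    countFrom 1 n inS                     ≡⟨ sym (+-identityʳ _) ⟩
    countFrom 1 n inS + 0                 ≡⟨ cong (λ b → countFrom 1 n inS + indicator b) (sym (sums-not-in-S n sum)) ⟩
    countFrom 1 n inS + indicator (inS (suc n)) ≡⟨ sym (countFrom-suc 1 n inS) ⟩
    countFrom 1 (suc n) inS               ∎
    where open ≡-Reasoning
  ... | false = begin
    countFrom 0 (read (suc n)) c                 ≡⟨ cong (λ z → countFrom 0 z c) (read-nonsum n sum) ⟩
    countFrom 0 (suc (read n)) c                 ≡⟨ countFrom-suc 0 (read n) c ⟩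
    countFrom 0 (read n) c + indicator (c (read n)) ≡⟨ cong₂ (λ a b → a + indicator b) (c-ones-read n) (S-follows-c n sum) ⟩
    countFrom 1 n inS + indicator (inS (suc n))  ≡⟨ sym (countFrom-suc 1 n inS) ⟩
    countFrom 1 (suc n) inS                      ∎
    where open ≡-Reasoning

  c-ones-before-pos : ∀ i → countFrom 0 (pos i) c ≡ i
  c-ones-before-pos zero    = refl
  c-ones-before-pos (suc i) = begin
    countFrom 0 (pos (suc i)) c                                          ≡⟨ cong (λ z → countFrom 0 z c) (pos-suc i) ⟩
    countFrom 0 (pos i + suc (μ (suc i))) c                              ≡⟨ countFrom-+ 0 (pos i) (suc (μ (suc i))) c ⟩
    countFrom 0 (pos i) c + (indicator (c (pos i)) + countFrom (suc (pos i)) (μ (suc i)) c)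
      ≡⟨ cong₂ (λ a b → a + (indicator b + countFrom (suc (pos i)) (μ (suc i)) c)) (c-ones-before-pos i) (c-pos i) ⟩
    i + suc (countFrom (suc (pos i)) (μ (suc i)) c)                     ≡⟨ cong (λ z → i + suc z) zeros ⟩
    i + 1                                                                ≡⟨ +-comm i 1 ⟩
    suc i                                                                ∎
    where
    open ≡-Reasoning
    zeros : countFrom (suc (pos i)) (μ (suc i)) c ≡ 0
    zeros = countFrom-none _ _ c λ t t<μ → c-false _ (¬pos t t<μ)
      where
      ¬pos : ∀ t → t < μ (suc i) → ∀ i′ → pos i′ ≢ suc (pos i) + t
      ¬pos t t<μ i′ e with i′ ≤? i
      ... | yes i′≤i = <⇒≱ (s≤s (m≤m+n (pos i) t)) (≤-trans (≤-reflexive (sym e)) (pos-mono-≤ i′ i i′≤i))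
      ... | no i′≰i  = <⇒≱ (subst (suc (pos i) + t <_) (sym (pos-suc i))
                              (subst (_< pos i + suc (μ (suc i))) (+-suc (pos i) t) (+-monoʳ-< (pos i) (s≤s t<μ))))
                         (≤-trans (pos-mono-≤ (suc i) i′ (≰⇒> i′≰i)) (≤-reflexive e))

  countS-<⇒< : ∀ x y → countS x < countS y → x < y
  countS-<⇒< x y lt with x <? y
  ... | yes x<y = x<y
  ... | no x≮y  = ⊥-elim (<⇒≱ lt (countFrom-mono 0 inS (≮⇒≥ x≮y)))

  c-one-at : ∀ q j → c q ≡ true → countFrom 0 q c ≡ j → q ≡ pos j
  c-one-at q j cq count with c-true⇒pos q cq
  ... | i , refl = cong pos (trans (sym (c-ones-before-pos i)) count)

  read-before-S : ∀ j x → inS (suc x) ≡ true → countS (suc x) ≡ j → read x ≡ pos j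
  read-before-S j x x∈S count =
    c-one-at (read x) j (trans (S-follows-c x (inS⇒¬inSS (suc x) x∈S)) x∈S) (trans (c-ones-read x) count)

  countS-len : ∀ m → countS (suc (len m)) ≡ 2 ^ m
  countS-len m = trans (countFrom-ext 1 1 (len m) inS (λ x → isOne (labelsAt m x)) λ i i<len →
                          cong isOne (label≡labelsAt m (suc i) i<len))
                   (Prefix.count-ones (prefixAt m))

  countS-shift : ∀ m x → 1 ≤ x → x ≤ len m → countS (len m + x) ≡ 2 ^ m + countS x
  countS-shift m (suc y) _ x≤len = begin
    countS (len m + suc y)                             ≡⟨ cong countS (+-suc (len m) y) ⟩
    countS (suc (len m) + y)                           ≡⟨ countFrom-+ 0 (suc (len m)) y inS ⟩
    countS (suc (len m)) + countFrom (suc (len m)) y inS ≡⟨ cong₂ _+_ (countS-len m) second ⟩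
    2 ^ m + countS (suc y)                             ∎
    where
    open ≡-Reasoning
    second : countFrom (suc (len m)) y inS ≡ countFrom 1 y inS
    second = countFrom-ext (suc (len m)) 1 y inS inS λ i i<y →
      trans (cong inS (sym (+-suc (len m) i))) (cong isOne (label-second m (suc i) (s≤s z≤n) (≤-trans (m≤n⇒m≤1+n i<y) x≤len)))

  -- Between consecutive elements of S the procedure reads exactly the block of
  -- μ (j + 1) zeros of c that separates the corresponding 1s of c.
  gap-length : ∀ j a b → inS a ≡ true → countS a ≡ j → inS b ≡ true → countS b ≡ suc j
             → b ≡ a + suc (μ (suc j) + countFrom (suc a) (b ∸ suc a) inSS)
  gap-length j zero b () _ _ _
  gap-length j (suc a′) b a∈S ca b∈S cb with m≤n⇒∃[o]m+o≡n (countS-<⇒< (suc a′) b (subst₂ _<_ (sym ca) (sym cb) ≤-refl))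
  ... | l , refl = begin
    suc a + l                          ≡⟨ cong (suc a +_) (sym (countFrom-not (suc a) l inSS)) ⟩
    suc a + (sums + nonsums)           ≡⟨ cong (λ z → suc a + (sums + z)) nonsums≡ ⟩
    suc a + (sums + μ (suc j))         ≡⟨ shape a sums (μ (suc j)) ⟩
    a + suc (μ (suc j) + sums)         ≡⟨ cong (λ z → a + suc (μ (suc j) + countFrom (suc a) z inSS)) (sym (m+n∸m≡n (suc a) l)) ⟩
    a + suc (μ (suc j) + countFrom (suc a) (suc a + l ∸ suc a) inSS) ∎
    where
    open ≡-Reasoning
    a = suc a′
    sums = countFrom (suc a) l inSS
    nonsums = countFrom (suc a) l (λ x → not (inSS x))
    shape : ∀ a x y → suc a + (x + y) ≡ a + suc (y + x)
    shape = solve-∀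
    read≡ : read (a + l) ≡ suc (pos j) + nonsums
    read≡ = trans (countFrom-+ 1 a l (λ x → not (inSS x)))
              (cong (_+ nonsums) (trans (read-nonsum a′ (inS⇒¬inSS a a∈S)) (cong suc (read-before-S j a′ a∈S ca))))
    nonsums≡ : nonsums ≡ μ (suc j)
    nonsums≡ = suc-injective (+-cancelˡ-≡ (pos j) _ _ (begin
      pos j + suc nonsums      ≡⟨ +-suc (pos j) nonsums ⟩
      suc (pos j) + nonsums    ≡⟨ sym read≡ ⟩
      read (a + l)             ≡⟨ read-before-S (suc j) (a + l) b∈S cb ⟩
      pos (suc j)              ≡⟨ pos-suc j ⟩
      pos j + suc (μ (suc j))  ∎))

  top≤len : ∀ m → top m ≤ len m
  top≤len m = ≤-trans (m≤m+n _ _) (Prefix.2p≤H (prefixAt m))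

  top∈S : ∀ m → inS (top m) ≡ true
  top∈S m = cong isOne (trans (label≡labelsAt m (top m) (top≤len m)) (Prefix.p-one (prefixAt m)))

  countS-top : ∀ m → countS (top m) + 1 ≡ 2 ^ m
  countS-top m = begin
    countS (top m) + 1
      ≡⟨ cong (countS (top m) +_) (sym (cong₂ _+_ (cong indicator (top∈S m)) none-above)) ⟩
    countS (top m) + (indicator (inS (top m)) + countFrom (suc (top m)) d inS)
      ≡⟨ sym (countFrom-+ 0 (top m) (suc d) inS) ⟩
    countS (top m + suc d)
      ≡⟨ cong countS (trans (+-suc (top m) d) (cong suc (m+[n∸m]≡n (top≤len m)))) ⟩
    countS (suc (len m))
      ≡⟨ countS-len m ⟩
    2 ^ m ∎
    where
    open ≡-Reasoning
    d = len m ∸ top m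
    not-one : ∀ x → top m < x → x ≤ len m → inS x ≡ false
    not-one x top<x x≤len with inS x in x∈S
    ... | false = refl
    ... | true  = ⊥-elim (<⇒≱ top<x (Prefix.one⇒≤p (prefixAt m) x x≤len
                    (trans (sym (label≡labelsAt m x x≤len)) (isOne⇒≡one _ x∈S))))
    none-above : countFrom (suc (top m)) d inS ≡ 0
    none-above = countFrom-none _ d inS λ i i<d → not-one (suc (top m) + i) (s≤s (m≤m+n (top m) i))
      (subst (_≤ len m) (+-suc (top m) i) (≤-trans (+-monoʳ-≤ (top m) i<d) (≤-reflexive (m+[n∸m]≡n (top≤len m)))))

  module Elements (s : ℕ → ℕ) (s-nth : ∀ n → IsNth c n (s n)) where

    s-inS : ∀ n → inS (s n) ≡ true
    s-inS n = trans (sym (inθ-correct (s n))) (proj₁ (s-nth n))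

    countS-s : ∀ n → countS (s n) ≡ n
    countS-s n = trans (countFrom-cong 0 (s n) inS (inθ c) (λ x → sym (inθ-correct x))) (proj₂ (s-nth n))

    s-unique : ∀ n x → inS x ≡ true → countS x ≡ n → s n ≡ x
    s-unique n x x∈S count with <-cmp (s n) x
    ... | tri< sn<x _ _ = ⊥-elim (<⇒≱ (countS-strict (s n) x (s-inS n) sn<x) (≤-reflexive (trans count (sym (countS-s n)))))
    ... | tri≈ _ sn≡x _ = sn≡x
    ... | tri> _ _ x<sn = ⊥-elim (<⇒≱ (countS-strict x (s n) x∈S x<sn) (≤-reflexive (trans (countS-s n) (sym count))))

    s-0 : s 0 ≡ 1
    s-0 = s-unique 0 1 (cong isOne (label≡labelsAt 0 1 (s≤s z≤n))) refl

    s-suc : ∀ j → s (suc j) ≡ s j + suc (μ (suc j) + α μ s (suc j))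
    s-suc j = trans (gap-length j (s j) (s (suc j)) (s-inS j) (countS-s j) (s-inS (suc j)) (countS-s (suc j)))
      (cong (λ z → s j + suc (μ (suc j) + z)) (sym (countFrom-cong (suc (s j)) (s (suc j) ∸ suc (s j)) (inθθ c) inSS inθθ-correct)))

    s-closed : ∀ n → s n ≡ suc (Σ1 n (λ i → μ i + α μ s i) + n)
    s-closed zero    = s-0
    s-closed (suc n) = trans (s-suc n) (trans (cong (_+ suc (μ (suc n) + α μ s (suc n))) (s-closed n)) (shape _ _ n))
      where shape : ∀ X Y n → suc (X + n) + suc Y ≡ suc (X + Y + suc n)
            shape = solve-∀

    s≤len : ∀ m k → k < 2 ^ m → s k ≤ len m
    s≤len m k k<2^m with s k ≤? len m
    ... | yes sk≤ = sk≤
    ... | no sk≰ = ⊥-elim (<⇒≱ k<2^m (begin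
      2 ^ m                  ≡⟨ sym (countS-len m) ⟩
      countS (suc (len m))   ≤⟨ countFrom-mono 0 inS (≰⇒> sk≰) ⟩
      countS (s k)           ≡⟨ countS-s k ⟩
      k                      ∎))
      where open ≤-Reasoning

    s-shift : ∀ m k → k < 2 ^ m → s (2 ^ m + k) ≡ len m + s k
    s-shift m k k<2^m = s-unique (2 ^ m + k) (len m + s k)
      (trans (cong isOne (label-second m (s k) 1≤sk sk≤)) (s-inS k))
      (trans (countS-shift m (s k) 1≤sk sk≤) (cong (2 ^ m +_) (countS-s k)))
      where
      1≤sk = inS-pos (s k) (s-inS k)
      sk≤ = s≤len m k k<2^m

    s-2^ : ∀ m → s (2 ^ m) ≡ len m + 1
    s-2^ m = trans (cong s (sym (+-identityʳ (2 ^ m)))) (trans (s-shift m 0 (1≤2^ m)) (cong (len m +_) s-0))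

    h≡len : ∀ m → h μ s (suc m) ≡ len m
    h≡len m = suc-injective (begin
      suc (Σ1 (2 ^ m) (λ i → μ i + α μ s i) + 2 ^ m) ≡⟨ sym (s-closed (2 ^ m)) ⟩
      s (2 ^ m)                                      ≡⟨ s-2^ m ⟩
      len m + 1                                      ≡⟨ +-comm (len m) 1 ⟩
      suc (len m)                                    ∎)
      where open ≡-Reasoning

    s-top : ∀ m P₀ → 2 ^ m ≡ suc P₀ → s P₀ ≡ top m
    s-top m P₀ P₀≡ = s-unique P₀ (top m) (top∈S m) (suc-injective (trans (+-comm 1 _) (trans (countS-top m) P₀≡)))

    α-2^ : ∀ m → α μ s (2 ^ m) ≡ gapStars m
    α-2^ m with 2^≡suc m
    ... | P₀ , P₀≡ = subst (λ z → α μ s z ≡ gapStars m) (sym P₀≡)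
                       (+-cancelˡ-≡ u _ _ (suc-injective (+-cancelˡ-≡ (top m) _ _ eq)))
      where
      open ≡-Reasoning
      u = μ (suc P₀)
      shape : ∀ t g u → t + g + u + 1 ≡ t + suc (u + g)
      shape = solve-∀
      eq : top m + suc (u + α μ s (suc P₀)) ≡ top m + suc (u + gapStars m)
      eq = begin
        top m + suc (u + α μ s (suc P₀))    ≡⟨ cong (_+ suc (u + α μ s (suc P₀))) (sym (s-top m P₀ P₀≡)) ⟩
        s P₀ + suc (u + α μ s (suc P₀))     ≡⟨ sym (s-suc P₀) ⟩
        s (suc P₀)                           ≡⟨ cong s (sym P₀≡) ⟩
        s (2 ^ m)                            ≡⟨ s-2^ m ⟩
        top m + gapStars m + μ (2 ^ m) + 1   ≡⟨ cong (λ z → top m + gapStars m + μ z + 1) P₀≡ ⟩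
        top m + gapStars m + u + 1           ≡⟨ shape (top m) (gapStars m) u ⟩
        top m + suc (u + gapStars m)         ∎

    α-shift : ∀ M K → 1 ≤ K → K < 2 ^ M → α μ s (2 ^ M + K) ≡ α μ s K
    α-shift M (suc K) _ K<2^M = trans (cong (α μ s) (+-suc (2 ^ M) K))
      (+-cancelˡ-≡ (μ (suc K)) _ _ (suc-injective (+-cancelˡ-≡ (s K) _ _ (+-cancelˡ-≡ (len M) _ _ eq))))
      where
      open ≡-Reasoning
      A = 2 ^ M + K
      μ≡ : μ (suc A) ≡ μ (suc K)
      μ≡ = trans (cong μ (sym (+-suc (2 ^ M) K))) (μ-shift M K K<2^M)
      eq : len M + (s K + suc (μ (suc K) + α μ s (suc A))) ≡ len M + (s K + suc (μ (suc K) + α μ s (suc K)))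
      eq = begin
        len M + (s K + suc (μ (suc K) + α μ s (suc A)))  ≡⟨ sym (+-assoc (len M) _ _) ⟩
        len M + s K + suc (μ (suc K) + α μ s (suc A))
          ≡⟨ cong₂ (λ a b → a + suc (b + α μ s (suc A))) (sym (s-shift M K (<⇒≤ K<2^M))) (sym μ≡) ⟩
        s A + suc (μ (suc A) + α μ s (suc A))            ≡⟨ sym (s-suc A) ⟩
        s (suc A)                                         ≡⟨ cong s (sym (+-suc (2 ^ M) K)) ⟩
        s (2 ^ M + suc K)                                 ≡⟨ s-shift M (suc K) K<2^M ⟩
        len M + s (suc K)                                 ≡⟨ cong (len M +_) (s-suc K) ⟩
        len M + (s K + suc (μ (suc K) + α μ s (suc K)))  ∎

    α-odd : ∀ k j → α μ s (2 ^ k * (2 * j + 1)) ≡ gapStars k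
    α-odd k = <-rec (λ j → α μ s (2 ^ k * (2 * j + 1)) ≡ gapStars k) step
      where
      step : ∀ j → (∀ {j′} → j′ < j → α μ s (2 ^ k * (2 * j′ + 1)) ≡ gapStars k) → α μ s (2 ^ k * (2 * j + 1)) ≡ gapStars k
      step zero    _  = trans (cong (α μ s) (*-identityʳ (2 ^ k))) (α-2^ k)
      step (suc j) ih with odd-split (suc j) (s≤s z≤n)
      ... | M , j′ , j′<j , split , small = begin
        α μ s (2 ^ k * (2 * suc j + 1))                    ≡⟨ cong (α μ s) n≡ ⟩
        α μ s (2 ^ (k + suc M) + 2 ^ k * (2 * j′ + 1))     ≡⟨ α-shift (k + suc M) _ 1≤K K< ⟩
        α μ s (2 ^ k * (2 * j′ + 1))                       ≡⟨ ih j′<j ⟩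
        gapStars k                                          ∎
        where
        open ≡-Reasoning
        n≡ : 2 ^ k * (2 * suc j + 1) ≡ 2 ^ (k + suc M) + 2 ^ k * (2 * j′ + 1)
        n≡ = begin
          2 ^ k * (2 * suc j + 1)                          ≡⟨ cong (2 ^ k *_) split ⟩
          2 ^ k * (2 ^ suc M + (2 * j′ + 1))               ≡⟨ *-distribˡ-+ (2 ^ k) (2 ^ suc M) _ ⟩
          2 ^ k * 2 ^ suc M + 2 ^ k * (2 * j′ + 1)         ≡⟨ cong (_+ 2 ^ k * (2 * j′ + 1)) (sym (^-distribˡ-+-* 2 k (suc M))) ⟩
          2 ^ (k + suc M) + 2 ^ k * (2 * j′ + 1)           ∎
        1≤K : 1 ≤ 2 ^ k * (2 * j′ + 1)
        1≤K = *-mono-≤ (1≤2^ k) (m≤n+m 1 (2 * j′))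
        K< : 2 ^ k * (2 * j′ + 1) < 2 ^ (k + suc M)
        K< = subst (2 ^ k * (2 * j′ + 1) <_) (sym (^-distribˡ-+-* 2 k (suc M))) (*-monoʳ-< (2 ^ k) {{m^n≢0 2 k}} small)

    s-binary : ∀ m (ε : ℕ → Bool) → let n = Σ1 m (λ i → bit (ε i) * 2 ^ (i ∸ 1)) in
               n < 2 ^ m × s n ≡ 1 + Σ1 m (λ i → bit (ε i) * h μ s i)
    s-binary zero    ε = s≤s z≤n , s-0
    s-binary (suc m) ε with s-binary m ε
    ... | n< , s≡ = digit (ε (suc m))
      where
      n = Σ1 m (λ i → bit (ε i) * 2 ^ (i ∸ 1))
      H = Σ1 m (λ i → bit (ε i) * h μ s i)
      digit : ∀ b → n + bit b * 2 ^ m < 2 ^ suc m × s (n + bit b * 2 ^ m) ≡ 1 + (H + bit b * h μ s (suc m))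
      digit false = subst (_< 2 ^ suc m) (sym (+-identityʳ n)) (≤-trans n< (subst (2 ^ m ≤_) (sym (2^-suc m)) (m≤m+n _ _))) ,
                    trans (cong s (+-identityʳ n)) (trans s≡ (cong suc (sym (+-identityʳ H))))
      digit true  = subst (_< 2 ^ suc m) n+2^m≡ (subst (2 ^ m + n <_) (sym (2^-suc m)) (+-monoʳ-< (2 ^ m) n<)) ,
                    (begin
                      s (n + 1 * 2 ^ m)           ≡⟨ cong s (sym n+2^m≡) ⟩
                      s (2 ^ m + n)               ≡⟨ s-shift m n n< ⟩
                      len m + s n                 ≡⟨ cong₂ _+_ (sym (h≡len m)) s≡ ⟩
                      h μ s (suc m) + (1 + H)     ≡⟨ shape (h μ s (suc m)) H ⟩
                      1 + (H + 1 * h μ s (suc m)) ∎)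
        where
        open ≡-Reasoning
        n+2^m≡ : 2 ^ m + n ≡ n + 1 * 2 ^ m
        n+2^m≡ = trans (+-comm (2 ^ m) n) (cong (n +_) (sym (*-identityˡ (2 ^ m))))
        shape : ∀ a y → a + (1 + y) ≡ 1 + (y + 1 * a)
        shape = solve-∀

mainTheorem2 : (μ : ℕ → ℕ)
    → (∀ m → 1 ≤ m → Σ1 (2 ^ m ∸ 1) μ + 2 ^ m + (3 ^ m ∸ 1) / 2 < μ (2 ^ m))
    → (∀ m → 1 ≤ m → ∀ k → 0 < k → k < 2 ^ m → μ (2 ^ m + k) ≡ μ k)
    → (s : ℕ → ℕ) → (∀ n → IsNth (cSeq μ) n (s n))
    → (∀ n → 1 ≤ n → ∀ k j → n ≡ 2 ^ k * (2 * j + 1) → α μ s n ≡ (3 ^ k + 1) / 2)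
      × (∀ n → 1 ≤ n → ∀ m (ε : ℕ → Bool) → n ≡ Σ1 m (λ i → bit (ε i) * 2 ^ (i ∸ 1))
           → s n ≡ 1 + Σ1 m (λ i → bit (ε i) * h μ s i))
mainTheorem2 μ μ-large μ-periodic s s-nth =
    (λ n _ k j n≡ → trans (cong (α μ s) n≡) (trans (α-odd k j) (sym (gapStars≡ k))))
  , (λ n _ m ε n≡ → trans (cong s n≡) (proj₂ (s-binary m ε)))
  where
  open Construction μ μ-large μ-periodic
  open Elements s s-nth
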